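{- Let $C\subseteq\mathbb{Z}_2^n$ be a subset of size $10$ and dimension $7$. Then $C$ is a cap if and only if $C$ has a basis of extended type $5\text{ - }5\text{ - }(2)$ or $5\text{ - }5\text{ - }(3)$.
   Context: Work in $\mathbb{Z}_2^n$. An affine combination of a set is a sum of an odd number of its distinct elements; $\operatorname{aff}(S)$ is the set of all affine combinations of elements of $S$, and the dimension of $S$ is the dimension of the affine flat $\operatorname{aff}(S)$. A basis for $S$ is a subset $B\subseteq S$ that is affinely independent (no element is an affine combination of the others) with $\operatorname{aff}(B)=\operatorname{aff}(S)$; its dependent set is $D=S\setminus B$. For $x\in D$, $B_x$ is the unique subset of $B$ whose elements sum to $x$. A quad is a set of four distinct elements summing to $\mathbf{0}$; a cap is a quad-free subset. For $D=\{x_1,x_2\}$, a basis $B$ has extended type $n_1\text{ - }n_2\text{ - }(m)$ if the elements of $D$ can be labeled $x_1,x_2$ so that $|B_{x_1}|=n_1$, $|B_{x_2}|=n_2$ and $|B_{x_1}\cap B_{x_2}|=m$. -}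

module Defs where

open import Data.Bool using (Bool; true; false; _xor_)
open import Data.Nat using (ℕ; _%_; _+_)
open import Data.Fin using (Fin)
open import Data.Vec using (Vec; zipWith; replicate)
open import Data.Vec.Properties using (≡-dec)
open import Data.List using (List; length; foldr; filter; lookup; removeAt)
open import Data.List.Membership.Propositional using (_∈_; _∉_)
open import Data.List.Membership.DecPropositional using () renaming (_∈?_ to ∈?-gen)
open import Data.List.Relation.Binary.Sublist.Propositional using (_⊆_)
open import Data.List.Relation.Unary.Unique.Propositional using (Unique)
open import Data.Product using (Σ; ∃; ∃-syntax; _×_)
open import Data.Sum using (_⊎_)
open import Relation.Binary.PropositionalEquality using (_≡_; _≢_)
open import Relation.Nullary using (¬_)
open import Relation.Nullary.Decidable using (_×-dec_)
import Data.Bool.Properties as BP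

Point : ℕ → Set
Point n = Vec Bool n

_⊕_ : ∀ {n} → Point n → Point n → Point n
_⊕_ = zipWith _xor_

𝟎 : ∀ {n} → Point n
𝟎 = replicate _ false

Σpts : ∀ {n} → List (Point n) → Point n
Σpts = foldr _⊕_ 𝟎

_≟pt_ : ∀ {n} (x y : Point n) → Relation.Nullary.Dec (x ≡ y)
_≟pt_ = ≡-dec BP._≟_

-- Finite sets of points are duplicate-free lists; subsets are sublists
-- (sublists of a duplicate-free list are duplicate-free).

Odd : ℕ → Set
Odd k = k % 2 ≡ 1

Aff : ∀ {n} → List (Point n) → Point n → Set
Aff S x = ∃[ T ] (T ⊆ S × Odd (length T) × Σpts T ≡ x)

SameAff : ∀ {n} → List (Point n) → List (Point n) → Set
SameAff A S = ∀ x → (Aff A x → Aff S x) × (Aff S x → Aff A x)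

AffIndep : ∀ {n} → List (Point n) → Set
AffIndep B = ∀ (i : Fin (length B)) → ¬ Aff (removeAt B i) (lookup B i)

-- dimension of S = dimension d of the affine flat aff(S), i.e. aff(S)
-- has an affine basis (affinely independent spanning set of points) of size d+1
HasDim : ∀ {n} → List (Point n) → ℕ → Set
HasDim {n} S d = ∃[ A ] (Unique A × AffIndep A × SameAff A S × length A ≡ d + 1)

IsBasis : ∀ {n} → List (Point n) → List (Point n) → Set
IsBasis S B = B ⊆ S × AffIndep B × SameAff B S

IsCap : ∀ {n} → List (Point n) → Set
IsCap S = ∀ T → T ⊆ S → length T ≡ 4 → Σpts T ≢ 𝟎

∣_∩_∣in_ : ∀ {n} → List (Point n) → List (Point n) → List (Point n) → ℕ
∣ T₁ ∩ T₂ ∣in B = length (filter (λ b → ∈?-gen _≟pt_ b T₁ ×-dec ∈?-gen _≟pt_ b T₂) B)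

-- B is a basis for S of extended type n1-n2-(m): D = S \ B = {x1,x2}
-- with |B_x1| = n1, |B_x2| = n2, |B_x1 ∩ B_x2| = m, where B_x is the
-- (unique) odd subset of B summing to x.
HasExtType : ∀ {n} → List (Point n) → List (Point n) → ℕ → ℕ → ℕ → Set
HasExtType S B n₁ n₂ m =
  Σ _ λ x₁ → Σ _ λ x₂ →
    x₁ ≢ x₂ × x₁ ∈ S × x₁ ∉ B × x₂ ∈ S × x₂ ∉ B ×
    (∀ x → x ∈ S → x ∉ B → x ≡ x₁ ⊎ x ≡ x₂) ×
    Σ _ λ T₁ → Σ _ λ T₂ →
      T₁ ⊆ B × Odd (length T₁) × Σpts T₁ ≡ x₁ ×
      T₂ ⊆ B × Odd (length T₂) × Σpts T₂ ≡ x₂ ×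
      length T₁ ≡ n₁ × length T₂ ≡ n₂ × ∣ T₁ ∩ T₂ ∣in B ≡ m

HasBasisOfExtType : ∀ {n} → List (Point n) → ℕ → ℕ → ℕ → Set
HasBasisOfExtType S n₁ n₂ m = ∃[ B ] (IsBasis S B × HasExtType S B n₁ n₂ m)

-- An affine relation of C (an even number of its points summing to 𝟎) is encoded by its
-- indicator vector; the relations form a GF(2)-space which, since 10 points span a flat of
-- dimension 7, has dimension 10 − 8 = 2.  A basis B = C ∖ {x₁, x₂} of extended type 5-5-(m)
-- is the same thing as two relations r₁, r₂ of weight 6 with xᵢ ∈ rᵢ ∖ rⱼ and |r₁ ∩ r₂| = m:
-- then rᵢ = B_{xᵢ} ∪ {xᵢ}, and every relation lies in {0, r₁, r₂, r₁ + r₂}, of weights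
-- 0, 6, 6 and 12 − 2m.  As the points are distinct, C is a cap iff no relation has weight 4.
-- If m ∈ {2, 3} none has.  Conversely, in a cap the three nonzero relations have even weights
-- at least 6 summing to 2 |r₁ ∪ r₂| ≤ 20, so two of them, r₁ and r₂, have weight 6; picking
-- xᵢ ∈ rᵢ ∖ rⱼ gives the basis, and 12 = 2m + |r₁ + r₂| with 6 ≤ |r₁ + r₂| ≤ 10 − m
-- forces m ∈ {2, 3}.
module Submission where

open import Defs
open import Algebra.Bundles using (CommutativeRing; CommutativeSemigroup)
open import Algebra.Structures using (IsCommutativeSemigroup)
import Algebra.Properties.CommutativeSemigroup as CommutativeSemigroupProperties
open import Data.Bool using (Bool; true; false; _xor_; _∧_; not)
open import Data.Bool.Properties
  using (xor-assoc; xor-comm; xor-identityˡ; xor-identityʳ; xor-same; true-xor; not-involutive;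
         not-distribʳ-xor; ∧-zeroʳ; ∧-identityʳ; xor-∧-commutativeRing)
  renaming (_≟_ to _≟ᵇ_)
open import Data.Empty using (⊥-elim)
open import Data.Fin using (Fin; zero; suc) renaming (_≟_ to _≟ᶠ_)
open import Data.List as List using (List; []; _∷_; length; filter; removeAt)
open import Data.List.Properties using (filter-accept; filter-reject)
open import Data.List.Membership.Propositional using (_∈_; _∉_)
open import Data.List.Membership.Propositional.Properties using (∈-lookup)
open import Data.List.Relation.Binary.Sublist.Propositional using (_⊆_; []; _∷_; _∷ʳ_; ⊆-trans; from∈)
open import Data.List.Relation.Binary.Sublist.Propositional.Properties using (All-resp-⊆)
open import Data.List.Relation.Unary.All as ListAll using ([]; _∷_)
open import Data.List.Relation.Unary.AllPairs using ([]; _∷_)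
open import Data.List.Relation.Unary.Any using (here; there; index)
open import Data.List.Relation.Unary.Any.Properties using (lookup-index)
open import Data.List.Relation.Unary.Unique.Propositional using (Unique)
open import Data.Nat using (ℕ; zero; suc; _+_; _*_; _≤_; _<_; z≤n; s≤s; _≤?_)
open import Data.Nat.Properties
  using (≤-reflexive; ≤-trans; ≤-antisym; ≤-pred; n≤1+n; n<1+n; n≮n; ≮⇒≥; ≰⇒>; m≤n⇒m≤1+n;
         m<1+n⇒m<n∨m≡n; m≤m+n; suc-injective; +-suc; *-suc; +-mono-≤; *-monoʳ-≤; module ≤-Reasoning)
open import Data.Nat.Tactic.RingSolver using (solve-∀)
open import Data.Product as Product using (∃; ∃-syntax; Σ-syntax; _×_; _,_; proj₁; proj₂)
open import Data.Sum as Sum using (_⊎_; inj₁; inj₂; [_,_]′)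
open import Data.Vec using (Vec; []; _∷_; tail; lookup; replicate; zipWith; tabulate; map; fromList; _[_]≔_)
open import Data.Vec.Properties
  using (zipWith-assoc; zipWith-comm; zipWith-identityˡ; zipWith-identityʳ; lookup-zipWith;
         lookup-replicate; lookup-map; tabulate∘lookup; tabulate-cong; lookup∘tabulate;
         lookup∘update; lookup∘update′; []≔-lookup; []≔-idempotent; ≡-dec)
open import Data.Vec.Relation.Unary.All as All using (All; []; _∷_; universal)
open import Data.Vec.Relation.Unary.All.Properties using (map⁺)
open import Function using (_∘_; id; case_of_)
open import Relation.Binary.PropositionalEquality
open import Relation.Binary.PropositionalEquality.Algebra using (isMagma)
open import Relation.Nullary using (¬_; Dec; yes; no)
open import Relation.Nullary.Decidable using (from-no)

private
  variable
    k n : ℕ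

open CommutativeSemigroupProperties (CommutativeRing.+-commutativeSemigroup xor-∧-commutativeRing)
  using () renaming (interchange to xor-interchange)

⊕-assoc : (u v w : Vec Bool k) → (u ⊕ v) ⊕ w ≡ u ⊕ (v ⊕ w)
⊕-assoc = zipWith-assoc xor-assoc

⊕-comm : (u v : Vec Bool k) → u ⊕ v ≡ v ⊕ u
⊕-comm = zipWith-comm xor-comm

⊕-isCommutativeSemigroup : IsCommutativeSemigroup _≡_ (_⊕_ {k})
⊕-isCommutativeSemigroup = record
  { isSemigroup = record { isMagma = isMagma _⊕_ ; assoc = ⊕-assoc }
  ; comm        = ⊕-comm
  }

⊕-commutativeSemigroup : ℕ → CommutativeSemigroup _ _
⊕-commutativeSemigroup k = record { isCommutativeSemigroup = ⊕-isCommutativeSemigroup {k} }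

module ⊕ {k} = CommutativeSemigroupProperties (⊕-commutativeSemigroup k)
  using (interchange; x∙yz≈y∙xz)

⊕-identityˡ : (u : Vec Bool k) → 𝟎 ⊕ u ≡ u
⊕-identityˡ = zipWith-identityˡ xor-identityˡ

⊕-identityʳ : (u : Vec Bool k) → u ⊕ 𝟎 ≡ u
⊕-identityʳ = zipWith-identityʳ xor-identityʳ

⊕-self : (u : Vec Bool k) → u ⊕ u ≡ 𝟎
⊕-self []      = refl
⊕-self (b ∷ u) = cong₂ _∷_ (xor-same b) (⊕-self u)

⊕-move : {u v w : Vec Bool k} → u ⊕ v ≡ w → u ≡ w ⊕ v
⊕-move {u = u} {v} {w} u⊕v≡w = begin
  u             ≡⟨ ⊕-identityʳ u ⟨
  u ⊕ 𝟎         ≡⟨ cong (u ⊕_) (⊕-self v) ⟨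
  u ⊕ (v ⊕ v)   ≡⟨ ⊕-assoc u v v ⟨
  (u ⊕ v) ⊕ v   ≡⟨ cong (_⊕ v) u⊕v≡w ⟩
  w ⊕ v         ∎
  where open ≡-Reasoning

⊕≡𝟎⇒≡ : (u v : Vec Bool k) → u ⊕ v ≡ 𝟎 → u ≡ v
⊕≡𝟎⇒≡ u v u⊕v≡𝟎 = trans (⊕-move u⊕v≡𝟎) (⊕-identityˡ v)

lookup-⊕ : (u v : Vec Bool k) (i : Fin k) → lookup (u ⊕ v) i ≡ lookup u i xor lookup v i
lookup-⊕ u v i = lookup-zipWith _xor_ i u v

lookup-𝟎 : (i : Fin k) → lookup (𝟎 {k}) i ≡ false
lookup-𝟎 i = lookup-replicate i false

≗⇒≡ : {A : Set} {u v : Vec A k} → (∀ i → lookup u i ≡ lookup v i) → u ≡ v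
≗⇒≡ {u = u} {v} u≗v = begin
  u                   ≡⟨ sym (tabulate∘lookup u) ⟩
  tabulate (lookup u) ≡⟨ tabulate-cong u≗v ⟩
  tabulate (lookup v) ≡⟨ tabulate∘lookup v ⟩
  v                   ∎
  where open ≡-Reasoning

𝟏 : Vec Bool k
𝟏 = replicate _ true

_⊓_ : Vec Bool k → Vec Bool k → Vec Bool k
_⊓_ = zipWith _∧_

infixr 25 _·_
infix 4 _⊑_

_·_ : Bool → Vec Bool n → Vec Bool n
true  · v = v
false · v = 𝟎

·-𝟎 : (b : Bool) → b · 𝟎 {n} ≡ 𝟎
·-𝟎 true  = refl
·-𝟎 false = refl

·-distrib-xor : (a b : Bool) (v : Vec Bool n) → (a xor b) · v ≡ a · v ⊕ b · v
·-distrib-xor false b     v = sym (⊕-identityˡ (b · v))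
·-distrib-xor true  false v = sym (⊕-identityʳ v)
·-distrib-xor true  true  v = sym (⊕-self v)

lookup-· : (b : Bool) (v : Vec Bool k) (i : Fin k) → lookup (b · v) i ≡ b ∧ lookup v i
lookup-· true  v i = refl
lookup-· false v i = lookup-𝟎 i

record _⊑_ (u v : Vec Bool k) : Set where
  constructor mk⊑
  field lookup-⊑ : ∀ i → lookup u i ≡ true → lookup v i ≡ true
open _⊑_

⊑-𝟏 : {u : Vec Bool k} → u ⊑ 𝟏
⊑-𝟏 = mk⊑ λ i _ → lookup-replicate i true

lookup-⊑-false : {u s : Vec Bool k} → u ⊑ s → ∀ {i} → lookup s i ≡ false → lookup u i ≡ false
lookup-⊑-false {u = u} u⊑s {i} s[i] with lookup u i in u[i]
... | true  = trans (sym (lookup-⊑ u⊑s i u[i])) s[i]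
... | false = refl

⊑-tail : {a b : Bool} {u v : Vec Bool k} → (a ∷ u) ⊑ (b ∷ v) → u ⊑ v
⊑-tail a∷u⊑b∷v = mk⊑ (lookup-⊑ a∷u⊑b∷v ∘ suc)

⊑-∷ : (a b : Bool) {u v : Vec Bool k} → (a ≡ true → b ≡ true) → u ⊑ v → (a ∷ u) ⊑ (b ∷ v)
⊑-∷ a b a⇒b u⊑v = mk⊑ λ { zero → a⇒b ; (suc i) → lookup-⊑ u⊑v i }

xor≡true : ∀ x y → x xor y ≡ true → x ≡ true ⊎ y ≡ true
xor≡true true  y _ = inj₁ refl
xor≡true false y p = inj₂ p

⊑-⊕ : {u v s : Vec Bool k} → u ⊑ s → v ⊑ s → u ⊕ v ⊑ s
⊑-⊕ {u = u} {v} u⊑s v⊑s = mk⊑ λ i u⊕v[i] →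
  [ lookup-⊑ u⊑s i , lookup-⊑ v⊑s i ]′ (xor≡true _ _ (trans (sym (lookup-⊕ u v i)) u⊕v[i]))

⊑-· : {v s : Vec Bool k} (b : Bool) → v ⊑ s → b · v ⊑ s
⊑-· true  v⊑s = v⊑s
⊑-· false v⊑s = mk⊑ λ i 𝟎[i] → case trans (sym (lookup-𝟎 i)) 𝟎[i] of λ ()

⊑-[]≔false : {u s : Vec Bool k} {p : Fin k} → u ⊑ s → lookup u p ≡ false → u ⊑ s [ p ]≔ false
⊑-[]≔false {u = u} {s} {p} u⊑s u[p] = mk⊑ lookup-⊑′
  where
  lookup-⊑′ : ∀ i → lookup u i ≡ true → lookup (s [ p ]≔ false) i ≡ true
  lookup-⊑′ i u[i] with i ≟ᶠ p
  ... | yes refl = case trans (sym u[i]) u[p] of λ ()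
  ... | no i≢p   = trans (lookup∘update′ i≢p s false) (lookup-⊑ u⊑s i u[i])

weight : Vec Bool k → ℕ
weight []          = 0
weight (true  ∷ v) = suc (weight v)
weight (false ∷ v) = weight v

parity : Vec Bool k → Bool
parity []      = false
parity (b ∷ v) = b xor parity v

parity-𝟎 : ∀ k → parity (𝟎 {k}) ≡ false
parity-𝟎 zero    = refl
parity-𝟎 (suc k) = parity-𝟎 k

parity-⊕ : (u v : Vec Bool k) → parity (u ⊕ v) ≡ parity u xor parity v
parity-⊕ []      []      = refl
parity-⊕ (a ∷ u) (b ∷ v) = begin
  (a xor b) xor parity (u ⊕ v)            ≡⟨ cong ((a xor b) xor_) (parity-⊕ u v) ⟩
  (a xor b) xor (parity u xor parity v)   ≡⟨ xor-interchange a b (parity u) (parity v) ⟩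
  (a xor parity u) xor (b xor parity v)   ∎
  where open ≡-Reasoning

odd : ℕ → Bool
odd zero    = false
odd (suc n) = not (odd n)

odd-weight : (v : Vec Bool k) → odd (weight v) ≡ parity v
odd-weight []          = refl
odd-weight (true  ∷ v) = trans (cong not (odd-weight v)) (sym (true-xor (parity v)))
odd-weight (false ∷ v) = odd-weight v

Odd⇒odd : ∀ n → Odd n → odd n ≡ true
Odd⇒odd 1             _     = refl
Odd⇒odd (suc (suc n)) odd-n = trans (not-involutive (odd n)) (Odd⇒odd n odd-n)

odd⇒Odd : ∀ n → odd n ≡ true → Odd n
odd⇒Odd 1             _     = refl
odd⇒Odd (suc (suc n)) odd-n = odd⇒Odd n (trans (sym (not-involutive (odd n))) odd-n)

Odd⇒¬Odd-suc : ∀ n → Odd n → ¬ Odd (suc n)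
Odd⇒¬Odd-suc 1             _     ()
Odd⇒¬Odd-suc (suc (suc n)) odd-n = Odd⇒¬Odd-suc n odd-n

¬Odd-suc⇒Odd : ∀ n → ¬ Odd (suc n) → Odd n
¬Odd-suc⇒Odd zero          even = ⊥-elim (even refl)
¬Odd-suc⇒Odd 1             _    = refl
¬Odd-suc⇒Odd (suc (suc n)) even = ¬Odd-suc⇒Odd n even

Odd-weight⁺ : (v : Vec Bool k) → parity v ≡ true → Odd (weight v)
Odd-weight⁺ v odd = odd⇒Odd (weight v) (trans (odd-weight v) odd)

Odd-weight⁻ : (v : Vec Bool k) → Odd (weight v) → parity v ≡ true
Odd-weight⁻ v odd = trans (sym (odd-weight v)) (Odd⇒odd (weight v) odd)

¬Odd-weight⁺ : (v : Vec Bool k) → parity v ≡ false → ¬ Odd (weight v)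
¬Odd-weight⁺ v even odd with () ← trans (sym even) (Odd-weight⁻ v odd)

¬Odd-weight⁻ : (v : Vec Bool k) → ¬ Odd (weight v) → parity v ≡ false
¬Odd-weight⁻ v even with parity v in p
... | true  = ⊥-elim (even (Odd-weight⁺ v p))
... | false = refl

weight-𝟎 : weight (𝟎 {k}) ≡ 0
weight-𝟎 {zero}  = refl
weight-𝟎 {suc k} = weight-𝟎 {k}

weight-𝟏 : weight (𝟏 {k}) ≡ k
weight-𝟏 {zero}  = refl
weight-𝟏 {suc k} = cong suc (weight-𝟏 {k})

weight≡0⇒𝟎 : (v : Vec Bool k) → weight v ≡ 0 → v ≡ 𝟎
weight≡0⇒𝟎 []          _ = refl
weight≡0⇒𝟎 (false ∷ v) w = cong (false ∷_) (weight≡0⇒𝟎 v w)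

weight-⊕ : (u v : Vec Bool k) → weight u + weight v ≡ 2 * weight (u ⊓ v) + weight (u ⊕ v)
weight-⊕ []          []          = refl
weight-⊕ (false ∷ u) (false ∷ v) = weight-⊕ u v
weight-⊕ (false ∷ u) (true  ∷ v) = begin
  weight u + suc (weight v)                  ≡⟨ +-suc (weight u) (weight v) ⟩
  suc (weight u + weight v)                  ≡⟨ cong suc (weight-⊕ u v) ⟩
  suc (2 * weight (u ⊓ v) + weight (u ⊕ v))  ≡⟨ +-suc (2 * weight (u ⊓ v)) (weight (u ⊕ v)) ⟨
  2 * weight (u ⊓ v) + suc (weight (u ⊕ v))  ∎
  where open ≡-Reasoning
weight-⊕ (true  ∷ u) (false ∷ v) = begin
  suc (weight u + weight v)                  ≡⟨ cong suc (weight-⊕ u v) ⟩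
  suc (2 * weight (u ⊓ v) + weight (u ⊕ v))  ≡⟨ +-suc (2 * weight (u ⊓ v)) (weight (u ⊕ v)) ⟨
  2 * weight (u ⊓ v) + suc (weight (u ⊕ v))  ∎
  where open ≡-Reasoning
weight-⊕ (true  ∷ u) (true  ∷ v) = begin
  suc (weight u + suc (weight v))                ≡⟨ cong suc (+-suc (weight u) (weight v)) ⟩
  suc (suc (weight u + weight v))                ≡⟨ cong (2 +_) (weight-⊕ u v) ⟩
  2 + (2 * weight (u ⊓ v) + weight (u ⊕ v))     ≡⟨ cong (_+ weight (u ⊕ v)) (*-suc 2 (weight (u ⊓ v))) ⟨
  2 * suc (weight (u ⊓ v)) + weight (u ⊕ v)      ∎
  where open ≡-Reasoning

weight-⊕-⊓ : (u v : Vec Bool k) → weight (u ⊕ v) + weight (u ⊓ v) ≤ k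
weight-⊕-⊓ []          []          = z≤n
weight-⊕-⊓ (false ∷ u) (false ∷ v) = m≤n⇒m≤1+n (weight-⊕-⊓ u v)
weight-⊕-⊓ (false ∷ u) (true  ∷ v) = s≤s (weight-⊕-⊓ u v)
weight-⊕-⊓ (true  ∷ u) (false ∷ v) = s≤s (weight-⊕-⊓ u v)
weight-⊕-⊓ (true  ∷ u) (true  ∷ v)
  rewrite +-suc (weight (u ⊕ v)) (weight (u ⊓ v)) = s≤s (weight-⊕-⊓ u v)

[]≔-id : (v : Vec Bool k) (p : Fin k) {b : Bool} → lookup v p ≡ b → v [ p ]≔ b ≡ v
[]≔-id v p v[p] = trans (cong (v [ p ]≔_) (sym v[p])) ([]≔-lookup v p)

weight-[]≔true : (v : Vec Bool k) (p : Fin k) → weight (v [ p ]≔ true) ≡ suc (weight (v [ p ]≔ false))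
weight-[]≔true (b     ∷ v) zero    = refl
weight-[]≔true (true  ∷ v) (suc p) = cong suc (weight-[]≔true v p)
weight-[]≔true (false ∷ v) (suc p) = weight-[]≔true v p

weight-pivot : (v : Vec Bool k) (p : Fin k) → lookup v p ≡ true → weight v ≡ suc (weight (v [ p ]≔ false))
weight-pivot v p v[p] = trans (cong weight (sym ([]≔-id v p v[p]))) (weight-[]≔true v p)

parity-[]≔true : (v : Vec Bool k) (p : Fin k) → parity (v [ p ]≔ true) ≡ not (parity (v [ p ]≔ false))
parity-[]≔true (b ∷ v) zero    = refl
parity-[]≔true (b ∷ v) (suc p) =
  trans (cong (b xor_) (parity-[]≔true v p)) (sym (not-distribʳ-xor b _))

parity-· : (b : Bool) (v : Vec Bool k) → parity (b · v) ≡ b ∧ parity v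
parity-· true  v = refl
parity-· {k = k} false v = parity-𝟎 k

𝟎-or-pivot : (v : Vec Bool k) → v ≡ 𝟎 ⊎ ∃[ p ] (lookup v p ≡ true)
𝟎-or-pivot []          = inj₁ refl
𝟎-or-pivot (true  ∷ v) = inj₂ (zero , refl)
𝟎-or-pivot (false ∷ v) = Sum.map (cong (false ∷_)) (Product.map suc id) (𝟎-or-pivot v)

pivot : (v : Vec Bool k) → v ≢ 𝟎 → ∃[ p ] (lookup v p ≡ true)
pivot v v≢𝟎 = [ ⊥-elim ∘ v≢𝟎 , id ]′ (𝟎-or-pivot v)

∃-difference : (u v : Vec Bool k) → weight v ≤ weight u → u ≢ v →
               ∃[ i ] (lookup u i ≡ true × lookup v i ≡ false)
∃-difference []          []          _     u≢v = ⊥-elim (u≢v refl)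
∃-difference (true  ∷ u) (false ∷ v) _     _   = zero , refl , refl
∃-difference (true  ∷ u) (true  ∷ v) wv≤wu u≢v =
  Product.map suc id (∃-difference u v (≤-pred wv≤wu) (u≢v ∘ cong (true ∷_)))
∃-difference (false ∷ u) (false ∷ v) wv≤wu u≢v =
  Product.map suc id (∃-difference u v wv≤wu (u≢v ∘ cong (false ∷_)))
∃-difference (false ∷ u) (true  ∷ v) wv<wu _ with ≡-dec _≟ᵇ_ u v
... | yes refl = ⊥-elim (n≮n _ wv<wu)
... | no u≢v   = Product.map suc id (∃-difference u v (≤-trans (n≤1+n _) wv<wu) u≢v)

⟦_⟧ : Vec (Point n) k → Vec Bool k → Point n
⟦ []    ⟧ []      = 𝟎
⟦ x ∷ M ⟧ (b ∷ w) = b · x ⊕ ⟦ M ⟧ w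

Additive : (Vec Bool k → Point n) → Set
Additive f = ∀ u v → f (u ⊕ v) ≡ f u ⊕ f v

additive-𝟎 : {f : Vec Bool k → Point n} → Additive f → f 𝟎 ≡ 𝟎
additive-𝟎 {f = f} f-additive = begin
  f 𝟎             ≡⟨ cong f (⊕-self 𝟎) ⟨
  f (𝟎 ⊕ 𝟎)       ≡⟨ f-additive 𝟎 𝟎 ⟩
  f 𝟎 ⊕ f 𝟎       ≡⟨ ⊕-self (f 𝟎) ⟩
  𝟎               ∎
  where open ≡-Reasoning

additive-· : {f : Vec Bool k → Point n} → Additive f → ∀ b v → f (b · v) ≡ b · f v
additive-· f-additive true  v = refl
additive-· f-additive false v = additive-𝟎 f-additive

⟦⟧-additive : (M : Vec (Point n) k) → Additive ⟦ M ⟧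
⟦⟧-additive []      []      []      = sym (⊕-self 𝟎)
⟦⟧-additive (x ∷ M) (a ∷ u) (b ∷ v) = begin
  (a xor b) · x ⊕ ⟦ M ⟧ (u ⊕ v)         ≡⟨ cong₂ _⊕_ (·-distrib-xor a b x) (⟦⟧-additive M u v) ⟩
  (a · x ⊕ b · x) ⊕ (⟦ M ⟧ u ⊕ ⟦ M ⟧ v) ≡⟨ ⊕.interchange (a · x) (b · x) (⟦ M ⟧ u) (⟦ M ⟧ v) ⟩
  (a · x ⊕ ⟦ M ⟧ u) ⊕ (b · x ⊕ ⟦ M ⟧ v) ∎
  where open ≡-Reasoning

⟦⟧-𝟎 : (M : Vec (Point n) k) → ⟦ M ⟧ 𝟎 ≡ 𝟎
⟦⟧-𝟎 M = additive-𝟎 (⟦⟧-additive M)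

⟦⟧-map : {f : Vec Bool k → Point n} → Additive f → ∀ {l} (M : Vec (Vec Bool k) l) w →
         ⟦ map f M ⟧ w ≡ f (⟦ M ⟧ w)
⟦⟧-map f-additive []      []      = sym (additive-𝟎 f-additive)
⟦⟧-map {f = f} f-additive (x ∷ M) (b ∷ w) = begin
  b · f x ⊕ ⟦ map f M ⟧ w   ≡⟨ cong₂ _⊕_ (sym (additive-· f-additive b x)) (⟦⟧-map f-additive M w) ⟩
  f (b · x) ⊕ f (⟦ M ⟧ w)   ≡⟨ f-additive (b · x) (⟦ M ⟧ w) ⟨
  f (b · x ⊕ ⟦ M ⟧ w)       ∎
  where open ≡-Reasoning

⟦⟧-[]≔true : (M : Vec (Point n) k) (w : Vec Bool k) (p : Fin k) →
             ⟦ M ⟧ (w [ p ]≔ true) ≡ lookup M p ⊕ ⟦ M ⟧ (w [ p ]≔ false)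
⟦⟧-[]≔true (x ∷ M) (b ∷ w) zero    = cong (x ⊕_) (sym (⊕-identityˡ (⟦ M ⟧ w)))
⟦⟧-[]≔true (x ∷ M) (b ∷ w) (suc p) =
  trans (cong (b · x ⊕_) (⟦⟧-[]≔true M w p)) (⊕.x∙yz≈y∙xz (b · x) (lookup M p) _)

parity-⟦⟧ : (M : Vec (Vec Bool n) k) → (∀ i → parity (lookup M i) ≡ true) →
            ∀ w → parity (⟦ M ⟧ w) ≡ parity w
parity-⟦⟧ {n = n} []      _        []      = parity-𝟎 n
parity-⟦⟧ (x ∷ M) odd-rows (b ∷ w) = begin
  parity (b · x ⊕ ⟦ M ⟧ w)              ≡⟨ parity-⊕ (b · x) (⟦ M ⟧ w) ⟩
  parity (b · x) xor parity (⟦ M ⟧ w)   ≡⟨ cong₂ _xor_ (parity-· b x) (parity-⟦⟧ M (odd-rows ∘ suc) w) ⟩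
  (b ∧ parity x) xor parity w           ≡⟨ cong (λ c → (b ∧ c) xor parity w) (odd-rows zero) ⟩
  (b ∧ true) xor parity w               ≡⟨ cong (_xor parity w) (∧-identityʳ b) ⟩
  b xor parity w                        ∎
  where open ≡-Reasoning

clear : Fin k → Vec Bool k → Vec Bool k → Vec Bool k
clear p r u = u ⊕ lookup u p · r

clear-additive : (p : Fin k) (r : Vec Bool k) → Additive (clear p r)
clear-additive p r u v = begin
  (u ⊕ v) ⊕ lookup (u ⊕ v) p · r                ≡⟨ cong (λ b → (u ⊕ v) ⊕ b · r) (lookup-⊕ u v p) ⟩
  (u ⊕ v) ⊕ (lookup u p xor lookup v p) · r     ≡⟨ cong ((u ⊕ v) ⊕_) (·-distrib-xor (lookup u p) (lookup v p) r) ⟩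
  (u ⊕ v) ⊕ (lookup u p · r ⊕ lookup v p · r)   ≡⟨ ⊕.interchange u v (lookup u p · r) (lookup v p · r) ⟩
  clear p r u ⊕ clear p r v                     ∎
  where open ≡-Reasoning

lookup-clear-pivot : (p : Fin k) {r : Vec Bool k} (u : Vec Bool k) → lookup r p ≡ true →
                     lookup (clear p r u) p ≡ false
lookup-clear-pivot p {r} u r[p] = begin
  lookup (u ⊕ lookup u p · r) p           ≡⟨ lookup-⊕ u _ p ⟩
  lookup u p xor lookup (lookup u p · r) p ≡⟨ cong (lookup u p xor_) (lookup-· (lookup u p) r p) ⟩
  lookup u p xor (lookup u p ∧ lookup r p) ≡⟨ cong (λ c → lookup u p xor (lookup u p ∧ c)) r[p] ⟩
  lookup u p xor (lookup u p ∧ true)       ≡⟨ cong (lookup u p xor_) (∧-identityʳ _) ⟩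
  lookup u p xor lookup u p                ≡⟨ xor-same (lookup u p) ⟩
  false                                    ∎
  where open ≡-Reasoning

lookup-clear : (p : Fin k) {r : Vec Bool k} (u : Vec Bool k) {i : Fin k} → lookup r i ≡ false →
               lookup (clear p r u) i ≡ lookup u i
lookup-clear p {r} u {i} r[i] = begin
  lookup (u ⊕ lookup u p · r) i            ≡⟨ lookup-⊕ u _ i ⟩
  lookup u i xor lookup (lookup u p · r) i ≡⟨ cong (lookup u i xor_) (lookup-· (lookup u p) r i) ⟩
  lookup u i xor (lookup u p ∧ lookup r i) ≡⟨ cong (λ c → lookup u i xor (lookup u p ∧ c)) r[i] ⟩
  lookup u i xor (lookup u p ∧ false)      ≡⟨ cong (lookup u i xor_) (∧-zeroʳ _) ⟩
  lookup u i xor false                     ≡⟨ xor-identityʳ _ ⟩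
  lookup u i                               ∎
  where open ≡-Reasoning

clear-⊑ : (p : Fin k) {r s u : Vec Bool k} → u ⊑ s → r ⊑ s → lookup r p ≡ true →
          clear p r u ⊑ s [ p ]≔ false
clear-⊑ p {u = u} u⊑s r⊑s r[p] = ⊑-[]≔false (⊑-⊕ u⊑s (⊑-· (lookup u p) r⊑s)) (lookup-clear-pivot p u r[p])

clear≡𝟎 : (p : Fin k) {r : Vec Bool k} (u : Vec Bool k) → clear p r u ≡ 𝟎 → u ≡ lookup u p · r
clear≡𝟎 p u = ⊕≡𝟎⇒≡ u _

⟦⟧-clear : (M : Vec (Point n) k) (p : Fin k) {r : Vec Bool k} (u : Vec Bool k) → ⟦ M ⟧ r ≡ 𝟎 →
           ⟦ M ⟧ (clear p r u) ≡ ⟦ M ⟧ u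
⟦⟧-clear M p {r} u Mr≡𝟎 = begin
  ⟦ M ⟧ (u ⊕ lookup u p · r)            ≡⟨ ⟦⟧-additive M u (lookup u p · r) ⟩
  ⟦ M ⟧ u ⊕ ⟦ M ⟧ (lookup u p · r)      ≡⟨ cong (⟦ M ⟧ u ⊕_) (additive-· (⟦⟧-additive M) (lookup u p) r) ⟩
  ⟦ M ⟧ u ⊕ lookup u p · ⟦ M ⟧ r        ≡⟨ cong (λ x → ⟦ M ⟧ u ⊕ lookup u p · x) Mr≡𝟎 ⟩
  ⟦ M ⟧ u ⊕ lookup u p · 𝟎              ≡⟨ cong (⟦ M ⟧ u ⊕_) (·-𝟎 (lookup u p)) ⟩
  ⟦ M ⟧ u ⊕ 𝟎                           ≡⟨ ⊕-identityʳ _ ⟩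
  ⟦ M ⟧ u                               ∎
  where open ≡-Reasoning

parity-clear : (p : Fin k) {r : Vec Bool k} (u : Vec Bool k) → parity r ≡ false →
               parity (clear p r u) ≡ parity u
parity-clear p {r} u even = begin
  parity (u ⊕ lookup u p · r)            ≡⟨ parity-⊕ u _ ⟩
  parity u xor parity (lookup u p · r)   ≡⟨ cong (parity u xor_) (parity-· (lookup u p) r) ⟩
  parity u xor (lookup u p ∧ parity r)   ≡⟨ cong (λ c → parity u xor (lookup u p ∧ c)) even ⟩
  parity u xor (lookup u p ∧ false)      ≡⟨ cong (parity u xor_) (∧-zeroʳ _) ⟩
  parity u xor false                     ≡⟨ xor-identityʳ _ ⟩
  parity u                               ∎
  where open ≡-Reasoning

-- Clearing a pivot of the first vector from the others shrinks the common support by one.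
dependency : ∀ {m} (s : Vec Bool m) (M : Vec (Vec Bool m) k) → weight s < k → All (_⊑ s) M →
             ∃[ w ] (w ≢ 𝟎 × ⟦ M ⟧ w ≡ 𝟎)
dependency s (v ∷ M) |s|<k (v⊑s ∷ M⊑s) with 𝟎-or-pivot v
... | inj₁ refl = (true ∷ 𝟎) , (λ ()) , trans (⊕-identityˡ (⟦ M ⟧ 𝟎)) (⟦⟧-𝟎 M)
... | inj₂ (p , v[p]) with dependency (s [ p ]≔ false) (map (clear p v) M) |s′|<k′ M′⊑s′
  where
  |s′|<k′ : weight (s [ p ]≔ false) < _
  |s′|<k′ = ≤-pred (subst (λ w → suc w ≤ _) (weight-pivot s p (lookup-⊑ v⊑s p v[p])) |s|<k)
  M′⊑s′ : All (_⊑ s [ p ]≔ false) (map (clear p v) M)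
  M′⊑s′ = map⁺ (All.map (λ u⊑s → clear-⊑ p u⊑s v⊑s v[p]) M⊑s)
... | w , w≢𝟎 , M′w≡𝟎 = (c ∷ w) , (w≢𝟎 ∘ cong tail) , (begin
  c · v ⊕ ⟦ M ⟧ w   ≡⟨ cong (c · v ⊕_) Mw≡c·v ⟩
  c · v ⊕ c · v     ≡⟨ ⊕-self (c · v) ⟩
  𝟎                 ∎)
  where
  open ≡-Reasoning
  c : Bool
  c = lookup (⟦ M ⟧ w) p
  Mw≡c·v : ⟦ M ⟧ w ≡ c · v
  Mw≡c·v = clear≡𝟎 p (⟦ M ⟧ w) (trans (sym (⟦⟧-map (clear-additive p v) M w)) M′w≡𝟎)

Unique-resp-⊇ : {A : Set} {S T : List A} → T ⊆ S → Unique S → Unique T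
Unique-resp-⊇ []         []          = []
Unique-resp-⊇ (y ∷ʳ T⊆S) (_ ∷ S!)    = Unique-resp-⊇ T⊆S S!
Unique-resp-⊇ (refl ∷ T⊆S) (x∉S ∷ S!) = All-resp-⊆ T⊆S x∉S ∷ Unique-resp-⊇ T⊆S S!

lookup-injective : {A : Set} {L : List A} → Unique L → ∀ {i j} → List.lookup L i ≡ List.lookup L j → i ≡ j
lookup-injective {L = x ∷ L} _          {zero}  {zero}  _ = refl
lookup-injective {L = x ∷ L} (x∉L ∷ _)  {zero}  {suc j} e = ⊥-elim (ListAll.lookup x∉L (∈-lookup j) e)
lookup-injective {L = x ∷ L} (x∉L ∷ _)  {suc i} {zero}  e = ⊥-elim (ListAll.lookup x∉L (∈-lookup i) (sym e))
lookup-injective {L = x ∷ L} (_ ∷ L!)   {suc i} {suc j} e = cong suc (lookup-injective L! e)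

lookup-fromList : {A : Set} (L : List A) (i : Fin (length L)) → lookup (fromList L) i ≡ List.lookup L i
lookup-fromList (x ∷ L) zero    = refl
lookup-fromList (x ∷ L) (suc i) = lookup-fromList L i

select : {A : Set} (L : List A) → Vec Bool (length L) → List A
select []      []          = []
select (x ∷ L) (true  ∷ v) = x ∷ select L v
select (x ∷ L) (false ∷ v) = select L v

module _ {A : Set} where

  length-select : (L : List A) (v : Vec Bool (length L)) → length (select L v) ≡ weight v
  length-select []      []          = refl
  length-select (x ∷ L) (true  ∷ v) = cong suc (length-select L v)
  length-select (x ∷ L) (false ∷ v) = length-select L v

  select-⊆ : (L : List A) (v : Vec Bool (length L)) → select L v ⊆ L
  select-⊆ []      []          = []
  select-⊆ (x ∷ L) (true  ∷ v) = refl ∷ select-⊆ L v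
  select-⊆ (x ∷ L) (false ∷ v) = x ∷ʳ select-⊆ L v

  select-𝟏 : (L : List A) → select L 𝟏 ≡ L
  select-𝟏 []      = refl
  select-𝟏 (x ∷ L) = cong (x ∷_) (select-𝟏 L)

  select-𝟎 : (L : List A) → select L 𝟎 ≡ []
  select-𝟎 []      = refl
  select-𝟎 (x ∷ L) = select-𝟎 L

  select-mono : (L : List A) {u v : Vec Bool (length L)} → u ⊑ v → select L u ⊆ select L v
  select-mono []      {[]}        {[]}        _   = []
  select-mono (x ∷ L) {true  ∷ u} {true  ∷ v} u⊑v = refl ∷ select-mono L (⊑-tail u⊑v)
  select-mono (x ∷ L) {true  ∷ u} {false ∷ v} u⊑v = case lookup-⊑ u⊑v zero refl of λ ()
  select-mono (x ∷ L) {false ∷ u} {true  ∷ v} u⊑v = x ∷ʳ select-mono L (⊑-tail u⊑v)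
  select-mono (x ∷ L) {false ∷ u} {false ∷ v} u⊑v = select-mono L (⊑-tail u⊑v)

  ⊆-select : (L : List A) (v : Vec Bool (length L)) {T : List A} → T ⊆ select L v →
             ∃[ u ] (u ⊑ v × select L u ≡ T)
  ⊆-select []      []          []          = [] , mk⊑ (λ ()) , refl
  ⊆-select (x ∷ L) (true  ∷ v) (.x ∷ʳ T⊆)  with ⊆-select L v T⊆
  ... | u , u⊑v , refl = (false ∷ u) , ⊑-∷ false true (λ ()) u⊑v , refl
  ⊆-select (x ∷ L) (true  ∷ v) (refl ∷ T⊆) with ⊆-select L v T⊆
  ... | u , u⊑v , refl = (true ∷ u) , ⊑-∷ true true id u⊑v , refl
  ⊆-select (x ∷ L) (false ∷ v) T⊆          with ⊆-select L v T⊆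
  ... | u , u⊑v , refl = (false ∷ u) , ⊑-∷ false false (λ ()) u⊑v , refl

  ⊆⇒select : (L : List A) {T : List A} → T ⊆ L → ∃[ u ] (select L u ≡ T)
  ⊆⇒select L T⊆L with ⊆-select L 𝟏 (subst (_ ⊆_) (sym (select-𝟏 L)) T⊆L)
  ... | u , _ , refl = u , refl

  select-∈ : (L : List A) (v : Vec Bool (length L)) (i : Fin (length L)) →
             lookup v i ≡ true → List.lookup L i ∈ select L v
  select-∈ (x ∷ L) (true  ∷ v) zero    _    = here refl
  select-∈ (x ∷ L) (true  ∷ v) (suc i) v[i] = there (select-∈ L v i v[i])
  select-∈ (x ∷ L) (false ∷ v) (suc i) v[i] = select-∈ L v i v[i]

  ∈-select : (L : List A) (v : Vec Bool (length L)) {y : A} → y ∈ select L v →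
             ∃[ i ] (lookup v i ≡ true × y ≡ List.lookup L i)
  ∈-select []      []          ()
  ∈-select (x ∷ L) (true  ∷ v) (here y≡x) = zero , refl , y≡x
  ∈-select (x ∷ L) (true  ∷ v) (there y∈) = Product.map suc id (∈-select L v y∈)
  ∈-select (x ∷ L) (false ∷ v) y∈         = Product.map suc id (∈-select L v y∈)

  ∈-select⇒lookup : {L : List A} → Unique L → (v : Vec Bool (length L)) (i : Fin (length L)) →
                    List.lookup L i ∈ select L v → lookup v i ≡ true
  ∈-select⇒lookup {L} L! v i Li∈ with ∈-select L v Li∈
  ... | j , v[j] , Li≡Lj rewrite lookup-injective L! Li≡Lj = v[j]

  filter-select : {P : A → Set} (P? : ∀ a → Dec (P a)) (L : List A) (v t : Vec Bool (length L)) →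
                  (∀ i → P (List.lookup L i) → lookup t i ≡ true) →
                  (∀ i → lookup t i ≡ true → P (List.lookup L i)) →
                  filter P? (select L v) ≡ select L (v ⊓ t)
  filter-select P? []      []          []          _ _ = refl
  filter-select P? (x ∷ L) (false ∷ v) (b     ∷ t) P⇒t t⇒P =
    filter-select P? L v t (P⇒t ∘ suc) (t⇒P ∘ suc)
  filter-select P? (x ∷ L) (true  ∷ v) (true  ∷ t) P⇒t t⇒P =
    trans (filter-accept P? (t⇒P zero refl)) (cong (x ∷_) (filter-select P? L v t (P⇒t ∘ suc) (t⇒P ∘ suc)))
  filter-select P? (x ∷ L) (true  ∷ v) (false ∷ t) P⇒t t⇒P =
    trans (filter-reject P? (λ Px → case P⇒t zero Px of λ ())) (filter-select P? L v t (P⇒t ∘ suc) (t⇒P ∘ suc))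

Σpts-select : (L : List (Point n)) (v : Vec Bool (length L)) → Σpts (select L v) ≡ ⟦ fromList L ⟧ v
Σpts-select []      []          = refl
Σpts-select (x ∷ L) (true  ∷ v) = cong (x ⊕_) (Σpts-select L v)
Σpts-select (x ∷ L) (false ∷ v) = trans (Σpts-select L v) (sym (⊕-identityˡ _))

uncons-⊆ : {A : Set} {S T : List A} {y : A} → (y ∷ T) ⊆ S → ∃[ i ] (List.lookup S i ≡ y × T ⊆ removeAt S i)
uncons-⊆ (x ∷ʳ yT⊆S)   = Product.map suc (Product.map₂ (x ∷ʳ_)) (uncons-⊆ yT⊆S)
uncons-⊆ (refl ∷ T⊆S)  = zero , refl , T⊆S

reinsert-⊆ : (S : List (Point n)) (i : Fin (length S)) {T : List (Point n)} → T ⊆ removeAt S i →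
  ∃[ T′ ] (T′ ⊆ S × length T′ ≡ suc (length T) × Σpts T′ ≡ List.lookup S i ⊕ Σpts T)
reinsert-⊆ (x ∷ S) zero    {T}     T⊆       = (x ∷ T) , (refl ∷ T⊆) , refl , refl
reinsert-⊆ (x ∷ S) (suc i)         (.x ∷ʳ T⊆) with reinsert-⊆ S i T⊆
... | T′ , T′⊆S , |T′| , ΣT′ = T′ , x ∷ʳ T′⊆S , |T′| , ΣT′
reinsert-⊆ (x ∷ S) (suc i) {.x ∷ T} (refl ∷ T⊆) with reinsert-⊆ S i T⊆
... | T′ , T′⊆S , |T′| , ΣT′ = (x ∷ T′) , (refl ∷ T′⊆S) , cong suc |T′| ,
  trans (cong (x ⊕_) ΣT′) (⊕.x∙yz≈y∙xz x (List.lookup S i) (Σpts T))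

Dependent : List (Point n) → Set
Dependent S = ∃[ T ] (T ⊆ S × T ≢ [] × ¬ Odd (length T) × Σpts T ≡ 𝟎)

AffIndep⇒¬Dependent : {S : List (Point n)} → AffIndep S → ¬ Dependent S
AffIndep⇒¬Dependent indep ([]      , _     , []≢[] , _    , _)    = []≢[] refl
AffIndep⇒¬Dependent indep ((y ∷ T) , yT⊆S , _     , even , Σ≡𝟎) with uncons-⊆ yT⊆S
... | i , Sᵢ≡y , T⊆ = indep i (T , T⊆ , ¬Odd-suc⇒Odd (length T) even , sym (trans Sᵢ≡y (⊕≡𝟎⇒≡ y (Σpts T) Σ≡𝟎)))

¬Dependent⇒AffIndep : {S : List (Point n)} → ¬ Dependent S → AffIndep S
¬Dependent⇒AffIndep {S = S} indep i (T , T⊆ , odd , ΣT≡Sᵢ) with reinsert-⊆ S i T⊆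
... | T′ , T′⊆S , |T′| , ΣT′ = indep (T′ , T′⊆S , T′≢[] , even , Σ≡𝟎)
  where
  T′≢[] : T′ ≢ []
  T′≢[] refl = case |T′| of λ ()
  even : ¬ Odd (length T′)
  even = subst (¬_ ∘ Odd) (sym |T′|) (Odd⇒¬Odd-suc (length T) odd)
  Σ≡𝟎 : Σpts T′ ≡ 𝟎
  Σ≡𝟎 = trans ΣT′ (trans (cong (List.lookup S i ⊕_) ΣT≡Sᵢ) (⊕-self _))

Relation : (L : List (Point n)) → Vec Bool (length L) → Set
Relation L w = parity w ≡ false × ⟦ fromList L ⟧ w ≡ 𝟎

Relation-⊕ : (L : List (Point n)) {u v : Vec Bool (length L)} → Relation L u → Relation L v → Relation L (u ⊕ v)
Relation-⊕ L {u} {v} (even-u , Σu) (even-v , Σv) =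
  trans (parity-⊕ u v) (cong₂ _xor_ even-u even-v) ,
  trans (⟦⟧-additive (fromList L) u v) (trans (cong₂ _⊕_ Σu Σv) (⊕-self 𝟎))

Dependent-select⁺ : (L : List (Point n)) {s w : Vec Bool (length L)} →
                    w ⊑ s → w ≢ 𝟎 → Relation L w → Dependent (select L s)
Dependent-select⁺ L {w = w} w⊑s w≢𝟎 (even , Σw) =
  select L w , select-mono L w⊑s , w≢𝟎 ∘ select≡[]⇒𝟎 ,
  subst (¬_ ∘ Odd) (sym (length-select L w)) (¬Odd-weight⁺ w even) , trans (Σpts-select L w) Σw
  where
  select≡[]⇒𝟎 : select L w ≡ [] → w ≡ 𝟎
  select≡[]⇒𝟎 e = weight≡0⇒𝟎 w (trans (sym (length-select L w)) (cong length e))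

Dependent⁺ : (L : List (Point n)) {w : Vec Bool (length L)} → w ≢ 𝟎 → Relation L w → Dependent L
Dependent⁺ L w≢𝟎 rel = subst Dependent (select-𝟏 L) (Dependent-select⁺ L ⊑-𝟏 w≢𝟎 rel)

Dependent-select⁻ : (L : List (Point n)) (s : Vec Bool (length L)) →
                    Dependent (select L s) → ∃[ w ] (w ⊑ s × w ≢ 𝟎 × Relation L w)
Dependent-select⁻ L s (T , T⊆ , T≢[] , even , ΣT) with ⊆-select L s T⊆
... | w , w⊑s , refl = w , w⊑s , w≢𝟎 ,
  ¬Odd-weight⁻ w (subst (¬_ ∘ Odd) (length-select L w) even) , trans (sym (Σpts-select L w)) ΣT
  where
  w≢𝟎 : w ≢ 𝟎
  w≢𝟎 refl = T≢[] (select-𝟎 L)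

Aff-select⁻ : (L : List (Point n)) (s : Vec Bool (length L)) {x : Point n} → Aff (select L s) x →
              ∃[ u ] (u ⊑ s × parity u ≡ true × ⟦ fromList L ⟧ u ≡ x)
Aff-select⁻ L s (T , T⊆ , odd , ΣT) with ⊆-select L s T⊆
... | u , u⊑s , refl =
  u , u⊑s , Odd-weight⁻ u (subst Odd (length-select L u) odd) , trans (sym (Σpts-select L u)) ΣT

Aff-select⁺ : (L : List (Point n)) {s u : Vec Bool (length L)} → u ⊑ s → parity u ≡ true →
              Aff (select L s) (⟦ fromList L ⟧ u)
Aff-select⁺ L {u = u} u⊑s odd =
  select L u , select-mono L u⊑s , subst Odd (sym (length-select L u)) (Odd-weight⁺ u odd) , Σpts-select L u

infix 4 _⊆ᵃ_

_⊆ᵃ_ : List (Point n) → List (Point n) → Set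
S ⊆ᵃ T = ∀ x → Aff S x → Aff T x

⊆⇒⊆ᵃ : {S T : List (Point n)} → S ⊆ T → S ⊆ᵃ T
⊆⇒⊆ᵃ S⊆T x (U , U⊆S , odd , ΣU) = U , ⊆-trans U⊆S S⊆T , odd , ΣU

Aff-lookup : (L : List (Point n)) (i : Fin (length L)) → Aff L (List.lookup L i)
Aff-lookup L i = (List.lookup L i ∷ []) , from∈ (∈-lookup i) , refl , ⊕-identityʳ _

dependent : {A L : List (Point n)} → length A < length L → L ⊆ᵃ A → ∃[ w ] (w ≢ 𝟎 × Relation L w)
dependent {A = A} {L} |A|<|L| L⊆ᵃA =
  let w , w≢𝟎 , rows·w≡𝟎 = dependency 𝟏 rows (subst (_< length L) (sym weight-𝟏) |A|<|L|)
                                       (universal (λ _ → ⊑-𝟏) rows)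
  in w , w≢𝟎 , even w rows·w≡𝟎 , Σ≡𝟎 w rows·w≡𝟎
  where
  row : ∀ i → ∃[ u ] (u ⊑ 𝟏 × parity u ≡ true × ⟦ fromList A ⟧ u ≡ List.lookup L i)
  row i = Aff-select⁻ A 𝟏 (subst (λ S → Aff S _) (sym (select-𝟏 A)) (L⊆ᵃA _ (Aff-lookup L i)))
  rows : Vec (Vec Bool (length A)) (length L)
  rows = tabulate (proj₁ ∘ row)
  lookup-rows : ∀ i → lookup rows i ≡ proj₁ (row i)
  lookup-rows = lookup∘tabulate (proj₁ ∘ row)
  odd-rows : ∀ i → parity (lookup rows i) ≡ true
  odd-rows i = subst (λ u → parity u ≡ true) (sym (lookup-rows i)) (proj₁ (proj₂ (proj₂ (row i))))
  L≡A·rows : fromList L ≡ map ⟦ fromList A ⟧ rows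
  L≡A·rows = ≗⇒≡ λ i → begin
    lookup (fromList L) i                ≡⟨ lookup-fromList L i ⟩
    List.lookup L i                      ≡⟨ proj₂ (proj₂ (proj₂ (row i))) ⟨
    ⟦ fromList A ⟧ (proj₁ (row i))       ≡⟨ cong ⟦ fromList A ⟧ (lookup-rows i) ⟨
    ⟦ fromList A ⟧ (lookup rows i)       ≡⟨ lookup-map i ⟦ fromList A ⟧ rows ⟨
    lookup (map ⟦ fromList A ⟧ rows) i   ∎
    where open ≡-Reasoning
  even : ∀ w → ⟦ rows ⟧ w ≡ 𝟎 → parity w ≡ false
  even w rows·w≡𝟎 = begin
    parity w                ≡⟨ parity-⟦⟧ rows odd-rows w ⟨
    parity (⟦ rows ⟧ w)     ≡⟨ cong parity rows·w≡𝟎 ⟩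
    parity (𝟎 {length A})  ≡⟨ parity-𝟎 (length A) ⟩
    false                   ∎
    where open ≡-Reasoning
  Σ≡𝟎 : ∀ w → ⟦ rows ⟧ w ≡ 𝟎 → ⟦ fromList L ⟧ w ≡ 𝟎
  Σ≡𝟎 w rows·w≡𝟎 = begin
    ⟦ fromList L ⟧ w                   ≡⟨ cong (λ M → ⟦ M ⟧ w) L≡A·rows ⟩
    ⟦ map ⟦ fromList A ⟧ rows ⟧ w      ≡⟨ ⟦⟧-map (⟦⟧-additive (fromList A)) rows w ⟩
    ⟦ fromList A ⟧ (⟦ rows ⟧ w)        ≡⟨ cong ⟦ fromList A ⟧ rows·w≡𝟎 ⟩
    ⟦ fromList A ⟧ 𝟎                   ≡⟨ ⟦⟧-𝟎 (fromList A) ⟩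
    𝟎                                  ∎
    where open ≡-Reasoning

AffIndep-length : {A L : List (Point n)} → AffIndep A → A ⊆ᵃ L → length A ≤ length L
AffIndep-length {A = A} A-indep A⊆ᵃL = ≮⇒≥ λ |L|<|A| →
  let w , w≢𝟎 , rel = dependent |L|<|A| A⊆ᵃL
  in AffIndep⇒¬Dependent A-indep (Dependent⁺ A w≢𝟎 rel)

⊆ᵃ-clear : (C : List (Point n)) {s r : Vec Bool (length C)} (p : Fin (length C)) →
           C ⊆ᵃ select C s → Relation C r → r ⊑ s → lookup r p ≡ true →
           C ⊆ᵃ select C (s [ p ]≔ false)
⊆ᵃ-clear C {s} p C⊆ᵃs (even , Σr) r⊑s r[p] x x∈ with Aff-select⁻ C s (C⊆ᵃs x x∈)
... | u , u⊑s , odd , Σu =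
  subst (Aff _) (trans (⟦⟧-clear (fromList C) p u Σr) Σu)
        (Aff-select⁺ C (clear-⊑ p u⊑s r⊑s r[p]) (trans (parity-clear p u even) odd))

relation-avoiding : {A C : List (Point n)} → 2 + length A ≤ length C → C ⊆ᵃ A →
  (y : Fin (length C)) → ∃[ w ] (w ≢ 𝟎 × Relation C w × lookup w y ≡ false)
relation-avoiding {A = A} {C} 2+|A|≤|C| C⊆ᵃA y =
  let w′ , w′≢𝟎 , rel′    = dependent |A|<|S| S⊆ᵃA
      w , w⊑s , w≢𝟎 , rel = Dependent-select⁻ C s (Dependent⁺ (select C s) w′≢𝟎 rel′)
  in w , w≢𝟎 , rel , lookup-⊑-false w⊑s (lookup∘update y 𝟏 false)
  where
  s : Vec Bool (length C)
  s = 𝟏 [ y ]≔ false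
  1+|s|≡|C| : suc (weight s) ≡ length C
  1+|s|≡|C| = trans (sym (weight-pivot 𝟏 y (lookup-replicate y true))) weight-𝟏
  |A|<|S| : length A < length (select C s)
  |A|<|S| = subst (length A <_) (sym (length-select C s))
                  (≤-pred (subst (2 + length A ≤_) (sym 1+|s|≡|C|) 2+|A|≤|C|))
  S⊆ᵃA : select C s ⊆ᵃ A
  S⊆ᵃA x = C⊆ᵃA x ∘ ⊆⇒⊆ᵃ (select-⊆ C s) x

two-relations : {A C : List (Point n)} → 2 + length A ≤ length C → C ⊆ᵃ A →
  ∃[ w₁ ] ∃[ w₂ ] ((w₁ ≢ 𝟎 × Relation C w₁) × (w₂ ≢ 𝟎 × Relation C w₂) × w₁ ≢ w₂)
two-relations 2+|A|≤|C| C⊆ᵃA =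
  let w₁ , w₁≢𝟎 , rel₁        = dependent (≤-trans (n≤1+n _) 2+|A|≤|C|) C⊆ᵃA
      y , w₁[y]               = pivot w₁ w₁≢𝟎
      w₂ , w₂≢𝟎 , rel₂ , w₂[y] = relation-avoiding 2+|A|≤|C| C⊆ᵃA y
  in w₁ , w₂ , (w₁≢𝟎 , rel₁) , (w₂≢𝟎 , rel₂) ,
     λ w₁≡w₂ → case trans (sym w₁[y]) (trans (cong (λ w → lookup w y) w₁≡w₂) w₂[y]) of λ ()

weight-sum : (u v : Vec Bool k) → weight u + weight v + weight (u ⊕ v) ≤ 2 * k
weight-sum {k} u v = begin
  weight u + weight v + weight (u ⊕ v)                       ≡⟨ cong (_+ weight (u ⊕ v)) (weight-⊕ u v) ⟩
  2 * weight (u ⊓ v) + weight (u ⊕ v) + weight (u ⊕ v)       ≡⟨ regroup (weight (u ⊓ v)) (weight (u ⊕ v)) ⟩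
  2 * (weight (u ⊕ v) + weight (u ⊓ v))                      ≤⟨ *-monoʳ-≤ 2 (weight-⊕-⊓ u v) ⟩
  2 * k                                                      ∎
  where
  open ≤-Reasoning
  regroup : ∀ m c → 2 * m + c + c ≡ 2 * (c + m)
  regroup = solve-∀

≡⊕⇒𝟎 : (u v : Vec Bool k) → u ≡ u ⊕ v → v ≡ 𝟎
≡⊕⇒𝟎 u v u≡u⊕v = begin
  v             ≡⟨ ⊕-identityˡ v ⟨
  𝟎 ⊕ v         ≡⟨ cong (_⊕ v) (⊕-self u) ⟨
  (u ⊕ u) ⊕ v   ≡⟨ ⊕-assoc u u v ⟩
  u ⊕ (u ⊕ v)   ≡⟨ cong (u ⊕_) u≡u⊕v ⟨
  u ⊕ u         ≡⟨ ⊕-self u ⟩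
  𝟎             ∎
  where open ≡-Reasoning

pair-sum≢𝟎 : {C : List (Point n)} → Unique C → ∀ T → T ⊆ C → length T ≡ 2 → Σpts T ≢ 𝟎
pair-sum≢𝟎 C! (y ∷ z ∷ []) T⊆C refl Σ≡𝟎 with Unique-resp-⊇ T⊆C C!
... | (y≢z ∷ []) ∷ _ = y≢z (trans (⊕≡𝟎⇒≡ y (z ⊕ 𝟎) Σ≡𝟎) (⊕-identityʳ z))

6≤-even : ∀ k → ¬ Odd k → k ≢ 0 → k ≢ 2 → k ≢ 4 → 6 ≤ k
6≤-even 0 _    k≢0 _   _   = ⊥-elim (k≢0 refl)
6≤-even 1 even _   _   _   = ⊥-elim (even refl)
6≤-even 2 _    _   k≢2 _   = ⊥-elim (k≢2 refl)
6≤-even 3 even _   _   _   = ⊥-elim (even refl)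
6≤-even 4 _    _   _   k≢4 = ⊥-elim (k≢4 refl)
6≤-even 5 even _   _   _   = ⊥-elim (even refl)
6≤-even (suc (suc (suc (suc (suc (suc k)))))) _ _ _ _ = s≤s (s≤s (s≤s (s≤s (s≤s (s≤s z≤n)))))

cap-relation-weight : {C : List (Point n)} → Unique C → IsCap C → {w : Vec Bool (length C)} →
                      w ≢ 𝟎 → Relation C w → 6 ≤ weight w
cap-relation-weight {C = C} C! cap {w} w≢𝟎 (even , Σw) =
  6≤-even (weight w) (¬Odd-weight⁺ w even) (w≢𝟎 ∘ weight≡0⇒𝟎 w)
    (λ |w|≡2 → pair-sum≢𝟎 C! (select C w) (select-⊆ C w) (trans (length-select C w) |w|≡2) Σ≡𝟎)
    (λ |w|≡4 → cap (select C w) (select-⊆ C w) (trans (length-select C w) |w|≡4) Σ≡𝟎)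
  where
  Σ≡𝟎 : Σpts (select C w) ≡ 𝟎
  Σ≡𝟎 = trans (Σpts-select C w) Σw

six-if-≤7 : ∀ {a} → 6 ≤ a × ¬ Odd a → a ≤ 7 → a ≡ 6
six-if-≤7 (6≤a , even) a≤7 with m<1+n⇒m<n∨m≡n (s≤s a≤7)
... | inj₁ a<7  = ≤-antisym (≤-pred a<7) 6≤a
... | inj₂ refl = ⊥-elim (even refl)

two-sixes : ∀ {a b c} → 6 ≤ a × ¬ Odd a → 6 ≤ b × ¬ Odd b → 6 ≤ c × ¬ Odd c → a + b + c ≤ 20 →
            (a ≡ 6 × b ≡ 6) ⊎ (a ≡ 6 × c ≡ 6) ⊎ (b ≡ 6 × c ≡ 6)
two-sixes {a} {b} {c} ha hb hc sum≤20 with a ≤? 7 | b ≤? 7 | c ≤? 7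
... | yes a≤7 | yes b≤7 | _       = inj₁ (six-if-≤7 ha a≤7 , six-if-≤7 hb b≤7)
... | yes a≤7 | no  _   | yes c≤7 = inj₂ (inj₁ (six-if-≤7 ha a≤7 , six-if-≤7 hc c≤7))
... | no  _   | yes b≤7 | yes c≤7 = inj₂ (inj₂ (six-if-≤7 hb b≤7 , six-if-≤7 hc c≤7))
... | _       | no  b≰7 | no  c≰7 =
  ⊥-elim (from-no (22 ≤? 20) (≤-trans (+-mono-≤ (+-mono-≤ (proj₁ ha) (≰⇒> b≰7)) (≰⇒> c≰7)) sum≤20))
... | no  a≰7 | _       | no  c≰7 =
  ⊥-elim (from-no (22 ≤? 20) (≤-trans (+-mono-≤ (+-mono-≤ (≰⇒> a≰7) (proj₁ hb)) (≰⇒> c≰7)) sum≤20))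
... | no  a≰7 | no  b≰7 | _       =
  ⊥-elim (from-no (22 ≤? 20) (≤-trans (+-mono-≤ (+-mono-≤ (≰⇒> a≰7) (≰⇒> b≰7)) (proj₁ hc)) sum≤20))

meet-2-or-3 : ∀ m c → 12 ≡ 2 * m + c → 6 ≤ c → c + m ≤ 10 → m ≡ 2 ⊎ m ≡ 3
meet-2-or-3 0 .12 refl _ c+m≤10 = ⊥-elim (from-no (12 ≤? 10) c+m≤10)
meet-2-or-3 1 .10 refl _ c+m≤10 = ⊥-elim (from-no (11 ≤? 10) c+m≤10)
meet-2-or-3 2 c    _    _ _      = inj₁ refl
meet-2-or-3 3 c    _    _ _      = inj₂ refl
meet-2-or-3 (suc (suc (suc (suc m)))) c 12≡ 6≤c _ =
  ⊥-elim (from-no (14 ≤? 12) (subst (14 ≤_) (sym 12≡) (+-mono-≤ (*-monoʳ-≤ 2 (m≤m+n 4 m)) 6≤c)))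

weight-6-pair : {C : List (Point n)} → Unique C → IsCap C → length C ≡ 10 →
  {w₁ w₂ : Vec Bool (length C)} → w₁ ≢ 𝟎 × Relation C w₁ → w₂ ≢ 𝟎 × Relation C w₂ → w₁ ≢ w₂ →
  ∃[ r₁ ] ∃[ r₂ ] (Relation C r₁ × Relation C r₂ × r₁ ≢ r₂ × weight r₁ ≡ 6 × weight r₂ ≡ 6)
weight-6-pair {C = C} C! cap |C|≡10 {w₁} {w₂} (w₁≢𝟎 , rel₁) (w₂≢𝟎 , rel₂) w₁≢w₂ =
  choose (two-sixes (bounds w₁≢𝟎 rel₁) (bounds w₂≢𝟎 rel₂) (bounds w₃≢𝟎 rel₃) sum≤20)
  where
  w₃ : Vec Bool (length C)
  w₃ = w₁ ⊕ w₂
  w₃≢𝟎 : w₃ ≢ 𝟎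
  w₃≢𝟎 = w₁≢w₂ ∘ ⊕≡𝟎⇒≡ w₁ w₂
  rel₃ : Relation C w₃
  rel₃ = Relation-⊕ C rel₁ rel₂
  bounds : ∀ {w} → w ≢ 𝟎 → Relation C w → 6 ≤ weight w × ¬ Odd (weight w)
  bounds {w} w≢𝟎 rel = cap-relation-weight C! cap w≢𝟎 rel , ¬Odd-weight⁺ w (proj₁ rel)
  sum≤20 : weight w₁ + weight w₂ + weight w₃ ≤ 20
  sum≤20 = subst (λ k → weight w₁ + weight w₂ + weight w₃ ≤ 2 * k) |C|≡10 (weight-sum w₁ w₂)
  choose : (weight w₁ ≡ 6 × weight w₂ ≡ 6) ⊎ (weight w₁ ≡ 6 × weight w₃ ≡ 6) ⊎ (weight w₂ ≡ 6 × weight w₃ ≡ 6) →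
           ∃[ r₁ ] ∃[ r₂ ] (Relation C r₁ × Relation C r₂ × r₁ ≢ r₂ × weight r₁ ≡ 6 × weight r₂ ≡ 6)
  choose (inj₁ (|w₁| , |w₂|))        = w₁ , w₂ , rel₁ , rel₂ , w₁≢w₂ , |w₁| , |w₂|
  choose (inj₂ (inj₁ (|w₁| , |w₃|))) = w₁ , w₃ , rel₁ , rel₃ , w₂≢𝟎 ∘ ≡⊕⇒𝟎 w₁ w₂ , |w₁| , |w₃|
  choose (inj₂ (inj₂ (|w₂| , |w₃|))) =
    w₂ , w₃ , rel₂ , rel₃ , (λ w₂≡w₃ → w₁≢𝟎 (≡⊕⇒𝟎 w₂ w₁ (trans w₂≡w₃ (⊕-comm w₁ w₂)))) , |w₂| , |w₃|

except : Fin k → Fin k → Vec Bool k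
except x₁ x₂ = 𝟏 [ x₁ ]≔ false [ x₂ ]≔ false

module _ {x₁ x₂ : Fin k} (x₁≢x₂ : x₁ ≢ x₂) where

  lookup-except₁ : lookup (except x₁ x₂) x₁ ≡ false
  lookup-except₁ = trans (lookup∘update′ x₁≢x₂ (𝟏 [ x₁ ]≔ false) false) (lookup∘update x₁ 𝟏 false)

  lookup-except₂ : lookup (except x₁ x₂) x₂ ≡ false
  lookup-except₂ = lookup∘update x₂ (𝟏 [ x₁ ]≔ false) false

  lookup-except : ∀ {i} → i ≢ x₁ → i ≢ x₂ → lookup (except x₁ x₂) i ≡ true
  lookup-except {i} i≢x₁ i≢x₂ =
    trans (lookup∘update′ i≢x₂ (𝟏 [ x₁ ]≔ false) false)
          (trans (lookup∘update′ i≢x₁ 𝟏 false) (lookup-replicate i true))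

  ⊑-except : {u : Vec Bool k} → lookup u x₁ ≡ false → lookup u x₂ ≡ false → u ⊑ except x₁ x₂
  ⊑-except {u} u[x₁] u[x₂] = mk⊑ λ i u[i] → lookup-except
    (λ { refl → case trans (sym u[i]) u[x₁] of λ () }) (λ { refl → case trans (sym u[i]) u[x₂] of λ () })

  weight-except : 2 + weight (except x₁ x₂) ≡ k
  weight-except = begin
    2 + weight (except x₁ x₂)        ≡⟨ cong suc (weight-pivot (𝟏 [ x₁ ]≔ false) x₂ 𝟏[x₂]) ⟨
    suc (weight (𝟏 [ x₁ ]≔ false))   ≡⟨ weight-pivot 𝟏 x₁ (lookup-replicate x₁ true) ⟨
    weight (𝟏 {k})                   ≡⟨ weight-𝟏 ⟩
    k                                ∎
    where
    open ≡-Reasoning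
    𝟏[x₂] : lookup (𝟏 [ x₁ ]≔ false) x₂ ≡ true
    𝟏[x₂] = trans (lookup∘update′ (x₁≢x₂ ∘ sym) 𝟏 false) (lookup-replicate x₂ true)

  ≡except : {b : Vec Bool k} → lookup b x₁ ≡ false → lookup b x₂ ≡ false →
            (∀ i → lookup b i ≡ false → i ≡ x₁ ⊎ i ≡ x₂) → b ≡ except x₁ x₂
  ≡except {b} b[x₁] b[x₂] only = ≗⇒≡ b≗except
    where
    b≗except : ∀ i → lookup b i ≡ lookup (except x₁ x₂) i
    b≗except i with i ≟ᶠ x₁ | i ≟ᶠ x₂
    ... | yes refl | _        = trans b[x₁] (sym lookup-except₁)
    ... | no _     | yes refl = trans b[x₂] (sym lookup-except₂)
    ... | no i≢x₁  | no i≢x₂ with lookup b i in b[i]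
    ...   | true  = sym (lookup-except i≢x₁ i≢x₂)
    ...   | false = ⊥-elim ([ i≢x₁ , i≢x₂ ]′ (only i b[i]))

  except-⊓ : {r₁ r₂ : Vec Bool k} → lookup r₂ x₁ ≡ false → lookup r₁ x₂ ≡ false →
             except x₁ x₂ ⊓ ((r₁ [ x₁ ]≔ false) ⊓ (r₂ [ x₂ ]≔ false)) ≡ r₁ ⊓ r₂
  except-⊓ {r₁} {r₂} r₂[x₁] r₁[x₂] = ≗⇒≡ pointwise
    where
    s t₁ t₂ : Vec Bool k
    s = except x₁ x₂
    t₁ = r₁ [ x₁ ]≔ false
    t₂ = r₂ [ x₂ ]≔ false
    lookup-⊓ : (u v : Vec Bool k) (i : Fin k) → lookup (u ⊓ v) i ≡ lookup u i ∧ lookup v i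
    lookup-⊓ u v i = lookup-zipWith _∧_ i u v
    pointwise : ∀ i → lookup (s ⊓ (t₁ ⊓ t₂)) i ≡ lookup (r₁ ⊓ r₂) i
    pointwise i with i ≟ᶠ x₁ | i ≟ᶠ x₂
    ... | yes refl | _ = begin
      lookup (s ⊓ (t₁ ⊓ t₂)) x₁                ≡⟨ lookup-⊓ s (t₁ ⊓ t₂) x₁ ⟩
      lookup s x₁ ∧ lookup (t₁ ⊓ t₂) x₁        ≡⟨ cong (_∧ lookup (t₁ ⊓ t₂) x₁) lookup-except₁ ⟩
      false                                    ≡⟨ ∧-zeroʳ (lookup r₁ x₁) ⟨
      lookup r₁ x₁ ∧ false                     ≡⟨ cong (lookup r₁ x₁ ∧_) r₂[x₁] ⟨
      lookup r₁ x₁ ∧ lookup r₂ x₁              ≡⟨ lookup-⊓ r₁ r₂ x₁ ⟨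
      lookup (r₁ ⊓ r₂) x₁                      ∎
      where open ≡-Reasoning
    ... | no _ | yes refl = begin
      lookup (s ⊓ (t₁ ⊓ t₂)) x₂                ≡⟨ lookup-⊓ s (t₁ ⊓ t₂) x₂ ⟩
      lookup s x₂ ∧ lookup (t₁ ⊓ t₂) x₂        ≡⟨ cong (_∧ lookup (t₁ ⊓ t₂) x₂) lookup-except₂ ⟩
      false                                    ≡⟨ cong (_∧ lookup r₂ x₂) r₁[x₂] ⟨
      lookup r₁ x₂ ∧ lookup r₂ x₂              ≡⟨ lookup-⊓ r₁ r₂ x₂ ⟨
      lookup (r₁ ⊓ r₂) x₂                      ∎
      where open ≡-Reasoning
    ... | no i≢x₁ | no i≢x₂ = begin
      lookup (s ⊓ (t₁ ⊓ t₂)) i                 ≡⟨ lookup-⊓ s (t₁ ⊓ t₂) i ⟩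
      lookup s i ∧ lookup (t₁ ⊓ t₂) i          ≡⟨ cong (_∧ lookup (t₁ ⊓ t₂) i) (lookup-except i≢x₁ i≢x₂) ⟩
      lookup (t₁ ⊓ t₂) i                       ≡⟨ lookup-⊓ t₁ t₂ i ⟩
      lookup t₁ i ∧ lookup t₂ i                ≡⟨ cong₂ _∧_ (lookup∘update′ i≢x₁ r₁ false) (lookup∘update′ i≢x₂ r₂ false) ⟩
      lookup r₁ i ∧ lookup r₂ i                ≡⟨ lookup-⊓ r₁ r₂ i ⟨
      lookup (r₁ ⊓ r₂) i                       ∎
      where open ≡-Reasoning

AffIndep-select⁺ : (L : List (Point n)) (s : Vec Bool (length L)) →
                   (∀ {w} → w ⊑ s → Relation L w → w ≡ 𝟎) → AffIndep (select L s)
AffIndep-select⁺ L s vanish = ¬Dependent⇒AffIndep λ dep →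
  let w , w⊑s , w≢𝟎 , rel = Dependent-select⁻ L s dep in w≢𝟎 (vanish w⊑s rel)

AffIndep-select⁻ : (L : List (Point n)) (s : Vec Bool (length L)) →
                   AffIndep (select L s) → ∀ {w} → w ⊑ s → Relation L w → w ≡ 𝟎
AffIndep-select⁻ L s indep {w} w⊑s rel with ≡-dec _≟ᵇ_ w 𝟎
... | yes w≡𝟎 = w≡𝟎
... | no  w≢𝟎 = ⊥-elim (AffIndep⇒¬Dependent indep (Dependent-select⁺ L w⊑s w≢𝟎 rel))

∣∩∣in-select : {C : List (Point n)} → Unique C → (s t₁ t₂ : Vec Bool (length C)) →
               ∣ select C t₁ ∩ select C t₂ ∣in select C s ≡ weight (s ⊓ (t₁ ⊓ t₂))
∣∩∣in-select {C = C} C! s t₁ t₂ =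
  trans (cong length (filter-select _ C s (t₁ ⊓ t₂) both⇒ ⇒both)) (length-select C (s ⊓ (t₁ ⊓ t₂)))
  where
  both⇒ : ∀ i → List.lookup C i ∈ select C t₁ × List.lookup C i ∈ select C t₂ → lookup (t₁ ⊓ t₂) i ≡ true
  both⇒ i (∈t₁ , ∈t₂) = trans (lookup-zipWith _∧_ i t₁ t₂)
    (cong₂ _∧_ (∈-select⇒lookup C! t₁ i ∈t₁) (∈-select⇒lookup C! t₂ i ∈t₂))
  ⇒both : ∀ i → lookup (t₁ ⊓ t₂) i ≡ true → List.lookup C i ∈ select C t₁ × List.lookup C i ∈ select C t₂
  ⇒both i t[i] with lookup t₁ i in t₁[i] | lookup t₂ i in t₂[i]
  ... | true  | true  = select-∈ C t₁ i t₁[i] , select-∈ C t₂ i t₂[i]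
  ... | true  | false = case trans (sym t[i]) (trans (lookup-zipWith _∧_ i t₁ t₂) (cong₂ _∧_ t₁[i] t₂[i])) of λ ()
  ... | false | _     = case trans (sym t[i]) (trans (lookup-zipWith _∧_ i t₁ t₂) (cong (_∧ _) t₁[i])) of λ ()

basis-set-sum : (C : List (Point n)) {r : Vec Bool (length C)} (x : Fin (length C)) →
                lookup r x ≡ true → Relation C r → ⟦ fromList C ⟧ (r [ x ]≔ false) ≡ List.lookup C x
basis-set-sum C {r} x r[x] (_ , Σr) = sym (⊕≡𝟎⇒≡ (List.lookup C x) _ (begin
  List.lookup C x ⊕ ⟦ fromList C ⟧ (r [ x ]≔ false)      ≡⟨ cong (_⊕ ⟦ fromList C ⟧ (r [ x ]≔ false)) (lookup-fromList C x) ⟨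
  lookup (fromList C) x ⊕ ⟦ fromList C ⟧ (r [ x ]≔ false) ≡⟨ ⟦⟧-[]≔true (fromList C) r x ⟨
  ⟦ fromList C ⟧ (r [ x ]≔ true)                          ≡⟨ cong ⟦ fromList C ⟧ ([]≔-id r x r[x]) ⟩
  ⟦ fromList C ⟧ r                                        ≡⟨ Σr ⟩
  𝟎                                                       ∎))
  where open ≡-Reasoning

relation-of-basis-set : (C : List (Point n)) {t : Vec Bool (length C)} (x : Fin (length C)) →
                        lookup t x ≡ false → parity t ≡ true → ⟦ fromList C ⟧ t ≡ List.lookup C x →
                        Relation C (t [ x ]≔ true)
relation-of-basis-set C {t} x t[x] odd Σt = even , Σ≡𝟎
  where
  t-unchanged : t [ x ]≔ false ≡ t
  t-unchanged = []≔-id t x t[x]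
  even : parity (t [ x ]≔ true) ≡ false
  even = trans (parity-[]≔true t x) (cong not (trans (cong parity t-unchanged) odd))
  Σ≡𝟎 : ⟦ fromList C ⟧ (t [ x ]≔ true) ≡ 𝟎
  Σ≡𝟎 = begin
    ⟦ fromList C ⟧ (t [ x ]≔ true)                          ≡⟨ ⟦⟧-[]≔true (fromList C) t x ⟩
    lookup (fromList C) x ⊕ ⟦ fromList C ⟧ (t [ x ]≔ false) ≡⟨ cong₂ _⊕_ (lookup-fromList C x) (cong ⟦ fromList C ⟧ t-unchanged) ⟩
    List.lookup C x ⊕ ⟦ fromList C ⟧ t                      ≡⟨ cong (List.lookup C x ⊕_) Σt ⟩
    List.lookup C x ⊕ List.lookup C x                       ≡⟨ ⊕-self _ ⟩
    𝟎                                                       ∎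
    where open ≡-Reasoning

-- For a basis B = C ∖ {x₁, x₂} of C, rᵢ is the indicator of B_{xᵢ} ∪ {xᵢ}.
record PivotPair (C : List (Point n)) (m : ℕ) : Set where
  field
    x₁ x₂       : Fin (length C)
    r₁ r₂       : Vec Bool (length C)
    relation₁   : Relation C r₁
    relation₂   : Relation C r₂
    r₁[x₁]      : lookup r₁ x₁ ≡ true
    r₂[x₂]      : lookup r₂ x₂ ≡ true
    r₁[x₂]      : lookup r₁ x₂ ≡ false
    r₂[x₁]      : lookup r₂ x₁ ≡ false
    weight₁     : weight r₁ ≡ 6
    weight₂     : weight r₂ ≡ 6
    weight-meet : weight (r₁ ⊓ r₂) ≡ m

  x₁≢x₂ : x₁ ≢ x₂
  x₁≢x₂ x₁≡x₂ = case trans (sym r₁[x₁]) (trans (cong (lookup r₁) x₁≡x₂) r₁[x₂]) of λ ()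

  basis : List (Point n)
  basis = select C (except x₁ x₂)

  meet-equation : 12 ≡ 2 * m + weight (r₁ ⊕ r₂)
  meet-equation = begin
    12                                      ≡⟨ cong₂ _+_ weight₁ weight₂ ⟨
    weight r₁ + weight r₂                   ≡⟨ weight-⊕ r₁ r₂ ⟩
    2 * weight (r₁ ⊓ r₂) + weight (r₁ ⊕ r₂) ≡⟨ cong (λ k → 2 * k + weight (r₁ ⊕ r₂)) weight-meet ⟩
    2 * m + weight (r₁ ⊕ r₂)                ∎
    where open ≡-Reasoning

  spans : C ⊆ᵃ basis
  spans = ⊆ᵃ-clear C x₂ (⊆ᵃ-clear C x₁ C⊆ᵃC relation₁ ⊑-𝟏 r₁[x₁]) relation₂ (⊑-[]≔false ⊑-𝟏 r₂[x₁]) r₂[x₂]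
    where
    C⊆ᵃC : C ⊆ᵃ select C 𝟏
    C⊆ᵃC = subst (C ⊆ᵃ_) (sym (select-𝟏 C)) (λ _ → id)

  -- A nonzero relation on the basis would let C ∖ {x₁, x₂, y} span aff C, which is too
  -- small to contain the independent set A.
  basis-AffIndep : {A : List (Point n)} → AffIndep A → A ⊆ᵃ C → length C ≡ 2 + length A → AffIndep basis
  basis-AffIndep {A} A-indep A⊆ᵃC |C|≡2+|A| = AffIndep-select⁺ C (except x₁ x₂) vanish
    where
    vanish : ∀ {w} → w ⊑ except x₁ x₂ → Relation C w → w ≡ 𝟎
    vanish {w} w⊑ rel with 𝟎-or-pivot w
    ... | inj₁ w≡𝟎       = w≡𝟎
    ... | inj₂ (y , w[y]) = ⊥-elim (n≮n (length A) (begin-strict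
      length A                           ≤⟨ AffIndep-length A-indep (λ x → C⊆ᵃS x ∘ A⊆ᵃC x) ⟩
      length (select C S)                ≡⟨ length-select C S ⟩
      weight S                           <⟨ n<1+n (weight S) ⟩
      suc (weight S)                     ≡⟨ weight-pivot (except x₁ x₂) y (lookup-⊑ w⊑ y w[y]) ⟨
      weight (except x₁ x₂)              ≡⟨ suc-injective (suc-injective (trans (weight-except x₁≢x₂) |C|≡2+|A|)) ⟩
      length A                           ∎))
      where
      open ≤-Reasoning
      S : Vec Bool (length C)
      S = except x₁ x₂ [ y ]≔ false
      C⊆ᵃS : C ⊆ᵃ select C S
      C⊆ᵃS = ⊆ᵃ-clear C y spans rel w⊑ w[y]

  decomposition : AffIndep basis → ∀ {q} → Relation C q → q ≡ lookup q x₂ · r₂ ⊕ lookup q x₁ · r₁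
  decomposition indep {q} (even , Σq) = ⊕-move (trans q₁≡ (cong (_· r₂) q₁[x₂]))
    where
    q₁ q₂ : Vec Bool (length C)
    q₁ = clear x₁ r₁ q
    q₂ = clear x₂ r₂ q₁
    q₂-relation : Relation C q₂
    q₂-relation =
      trans (parity-clear x₂ q₁ (proj₁ relation₂)) (trans (parity-clear x₁ q (proj₁ relation₁)) even) ,
      trans (⟦⟧-clear (fromList C) x₂ q₁ (proj₂ relation₂)) (trans (⟦⟧-clear (fromList C) x₁ q (proj₂ relation₁)) Σq)
    q₂⊑ : q₂ ⊑ except x₁ x₂
    q₂⊑ = ⊑-except x₁≢x₂ (trans (lookup-clear x₂ q₁ r₂[x₁]) (lookup-clear-pivot x₁ q r₁[x₁]))
                          (lookup-clear-pivot x₂ q₁ r₂[x₂])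
    q₁≡ : q₁ ≡ lookup q₁ x₂ · r₂
    q₁≡ = clear≡𝟎 x₂ q₁ (AffIndep-select⁻ C (except x₁ x₂) indep q₂⊑ q₂-relation)
    q₁[x₂] : lookup q₁ x₂ ≡ lookup q x₂
    q₁[x₂] = lookup-clear x₁ q r₁[x₂]

  span-weight≢4 : m ≡ 2 ⊎ m ≡ 3 → ∀ a c → weight (c · r₂ ⊕ a · r₁) ≢ 4
  span-weight≢4 _ false false |q|≡4 = case trans (sym |q|≡4) (trans (cong weight (⊕-self (𝟎 {length C}))) (weight-𝟎 {length C})) of λ ()
  span-weight≢4 _ true  false |q|≡4 = case trans (sym |q|≡4) (trans (cong weight (⊕-identityˡ r₁)) weight₁) of λ ()
  span-weight≢4 _ false true  |q|≡4 = case trans (sym |q|≡4) (trans (cong weight (⊕-identityʳ r₂)) weight₂) of λ ()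
  span-weight≢4 m∈ true true  |q|≡4 = [ (λ m≡2 → subst (λ m → 12 ≢ 2 * m + 4) (sym m≡2) (λ ()) 12≡)
                                      , (λ m≡3 → subst (λ m → 12 ≢ 2 * m + 4) (sym m≡3) (λ ()) 12≡) ]′ m∈
    where
    12≡ : 12 ≡ 2 * m + 4
    12≡ = trans meet-equation (cong (2 * m +_) (trans (cong weight (⊕-comm r₁ r₂)) |q|≡4))

  isCap : m ≡ 2 ⊎ m ≡ 3 → AffIndep basis → IsCap C
  isCap m∈ indep T T⊆C |T|≡4 ΣT≡𝟎 with ⊆⇒select C T⊆C
  ... | q , refl = span-weight≢4 m∈ (lookup q x₁) (lookup q x₂) (begin
    weight (lookup q x₂ · r₂ ⊕ lookup q x₁ · r₁)   ≡⟨ cong weight (decomposition indep q-relation) ⟨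
    weight q                                       ≡⟨ length-select C q ⟨
    length (select C q)                            ≡⟨ |T|≡4 ⟩
    4                                              ∎)
    where
    open ≡-Reasoning
    q-relation : Relation C q
    q-relation = ¬Odd-weight⁻ q (λ odd → case subst Odd (trans (sym (length-select C q)) |T|≡4) odd of λ ()) ,
                 trans (sym (Σpts-select C q)) ΣT≡𝟎

  lookup-∉basis : Unique C → ∀ {x} → lookup (except x₁ x₂) x ≡ false → List.lookup C x ∉ basis
  lookup-∉basis C! {x} except[x] Cₓ∈basis =
    case trans (sym (∈-select⇒lookup C! (except x₁ x₂) x Cₓ∈basis)) except[x] of λ ()

  ∉basis : ∀ y → y ∈ C → y ∉ basis → y ≡ List.lookup C x₁ ⊎ y ≡ List.lookup C x₂
  ∉basis y y∈C y∉basis with index y∈C ≟ᶠ x₁ | index y∈C ≟ᶠ x₂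
  ... | yes i≡x₁ | _        = inj₁ (trans (lookup-index y∈C) (cong (List.lookup C) i≡x₁))
  ... | no  _    | yes i≡x₂ = inj₂ (trans (lookup-index y∈C) (cong (List.lookup C) i≡x₂))
  ... | no  i≢x₁ | no  i≢x₂ = ⊥-elim (y∉basis (subst (_∈ basis) (sym (lookup-index y∈C))
                                (select-∈ C (except x₁ x₂) (index y∈C) (lookup-except x₁≢x₂ i≢x₁ i≢x₂))))

  hasBasisOfExtType : Unique C → AffIndep basis → HasBasisOfExtType C 5 5 m
  hasBasisOfExtType C! indep =
    basis , (select-⊆ C _ , indep , λ x → ⊆⇒⊆ᵃ (select-⊆ C _) x , spans x) ,
    List.lookup C x₁ , List.lookup C x₂ , x₁≢x₂ ∘ lookup-injective C! ,
    ∈-lookup x₁ , lookup-∉basis C! (lookup-except₁ x₁≢x₂) ,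
    ∈-lookup x₂ , lookup-∉basis C! (lookup-except₂ x₁≢x₂) , ∉basis ,
    select C t₁ , select C t₂ ,
    select-mono C t₁⊑ , Odd-length t₁ |t₁|≡5 , trans (Σpts-select C t₁) (basis-set-sum C x₁ r₁[x₁] relation₁) ,
    select-mono C t₂⊑ , Odd-length t₂ |t₂|≡5 , trans (Σpts-select C t₂) (basis-set-sum C x₂ r₂[x₂] relation₂) ,
    trans (length-select C t₁) |t₁|≡5 , trans (length-select C t₂) |t₂|≡5 ,
    trans (∣∩∣in-select C! (except x₁ x₂) t₁ t₂) (trans (cong weight (except-⊓ x₁≢x₂ r₂[x₁] r₁[x₂])) weight-meet)
    where
    t₁ t₂ : Vec Bool (length C)
    t₁ = r₁ [ x₁ ]≔ false
    t₂ = r₂ [ x₂ ]≔ false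
    t₁⊑ : t₁ ⊑ except x₁ x₂
    t₁⊑ = ⊑-except x₁≢x₂ (lookup∘update x₁ r₁ false) (trans (lookup∘update′ (x₁≢x₂ ∘ sym) r₁ false) r₁[x₂])
    t₂⊑ : t₂ ⊑ except x₁ x₂
    t₂⊑ = ⊑-except x₁≢x₂ (trans (lookup∘update′ x₁≢x₂ r₂ false) r₂[x₁]) (lookup∘update x₂ r₂ false)
    |t₁|≡5 : weight t₁ ≡ 5
    |t₁|≡5 = suc-injective (trans (sym (weight-pivot r₁ x₁ r₁[x₁])) weight₁)
    |t₂|≡5 : weight t₂ ≡ 5
    |t₂|≡5 = suc-injective (trans (sym (weight-pivot r₂ x₂ r₂[x₂])) weight₂)
    Odd-length : ∀ t → weight t ≡ 5 → Odd (length (select C t))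
    Odd-length t |t|≡5 = subst Odd (sym (trans (length-select C t) |t|≡5)) refl

pivotPair⁺ : {C : List (Point n)} → Unique C → IsCap C → length C ≡ 10 →
  {r₁ r₂ : Vec Bool (length C)} → Relation C r₁ → Relation C r₂ → r₁ ≢ r₂ → weight r₁ ≡ 6 → weight r₂ ≡ 6 →
  Σ[ m ∈ ℕ ] ((m ≡ 2 ⊎ m ≡ 3) × PivotPair C m)
pivotPair⁺ {C = C} C! cap |C|≡10 {r₁} {r₂} rel₁ rel₂ r₁≢r₂ |r₁| |r₂| =
  let x₁ , r₁[x₁] , r₂[x₁] = ∃-difference r₁ r₂ (≤-reflexive (trans |r₂| (sym |r₁|))) r₁≢r₂
      x₂ , r₂[x₂] , r₁[x₂] = ∃-difference r₂ r₁ (≤-reflexive (trans |r₁| (sym |r₂|))) (r₁≢r₂ ∘ sym)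
      P : PivotPair C (weight (r₁ ⊓ r₂))
      P = record
        { x₁ = x₁ ; x₂ = x₂ ; r₁ = r₁ ; r₂ = r₂ ; relation₁ = rel₁ ; relation₂ = rel₂
        ; r₁[x₁] = r₁[x₁] ; r₂[x₂] = r₂[x₂] ; r₁[x₂] = r₁[x₂] ; r₂[x₁] = r₂[x₁]
        ; weight₁ = |r₁| ; weight₂ = |r₂| ; weight-meet = refl
        }
  in weight (r₁ ⊓ r₂) , meet-2-or-3 _ _ (PivotPair.meet-equation P) 6≤|r₁⊕r₂| |r₁⊕r₂|+m≤10 , P
  where
  6≤|r₁⊕r₂| : 6 ≤ weight (r₁ ⊕ r₂)
  6≤|r₁⊕r₂| = cap-relation-weight C! cap (r₁≢r₂ ∘ ⊕≡𝟎⇒≡ r₁ r₂) (Relation-⊕ C rel₁ rel₂)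
  |r₁⊕r₂|+m≤10 : weight (r₁ ⊕ r₂) + weight (r₁ ⊓ r₂) ≤ 10
  |r₁⊕r₂|+m≤10 = subst (weight (r₁ ⊕ r₂) + weight (r₁ ⊓ r₂) ≤_) |C|≡10 (weight-⊕-⊓ r₁ r₂)

completed-relation : (C : List (Point n)) {t : Vec Bool (length C)} (x : Fin (length C)) →
  lookup t x ≡ false → Odd (length (select C t)) → Σpts (select C t) ≡ List.lookup C x → length (select C t) ≡ 5 →
  Relation C (t [ x ]≔ true) × weight (t [ x ]≔ true) ≡ 6
completed-relation C {t} x t[x] odd Σt |T|≡5 =
  relation-of-basis-set C x t[x] (Odd-weight⁻ t (subst Odd (length-select C t) odd)) (trans (sym (Σpts-select C t)) Σt) ,
  trans (weight-[]≔true t x) (cong suc (trans (cong weight ([]≔-id t x t[x])) (trans (sym (length-select C t)) |T|≡5)))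

index-≢ : {A : Set} {L : List A} {p₁ p₂ : A} (p₁∈L : p₁ ∈ L) (p₂∈L : p₂ ∈ L) → p₁ ≢ p₂ → index p₁∈L ≢ index p₂∈L
index-≢ {L = L} p₁∈L p₂∈L p₁≢p₂ i₁≡i₂ =
  p₁≢p₂ (trans (lookup-index p₁∈L) (trans (cong (List.lookup L) i₁≡i₂) (sym (lookup-index p₂∈L))))

≡except-index : {C : List (Point n)} → Unique C → (b : Vec Bool (length C)) {p₁ p₂ : Point n}
  (p₁∈C : p₁ ∈ C) (p₂∈C : p₂ ∈ C) → p₁ ≢ p₂ → p₁ ∉ select C b → p₂ ∉ select C b →
  (∀ y → y ∈ C → y ∉ select C b → y ≡ p₁ ⊎ y ≡ p₂) → b ≡ except (index p₁∈C) (index p₂∈C)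
≡except-index {C = C} C! b p₁∈C p₂∈C p₁≢p₂ p₁∉B p₂∉B only =
  ≡except (index-≢ p₁∈C p₂∈C p₁≢p₂) (b[p] p₁∈C p₁∉B) (b[p] p₂∈C p₂∉B) b-only
  where
  b[p] : ∀ {p} (p∈C : p ∈ C) → p ∉ select C b → lookup b (index p∈C) ≡ false
  b[p] p∈C p∉B with lookup b (index p∈C) in b[i]
  ... | true  = ⊥-elim (p∉B (subst (_∈ select C b) (sym (lookup-index p∈C)) (select-∈ C b _ b[i])))
  ... | false = refl
  b-only : ∀ i → lookup b i ≡ false → i ≡ index p₁∈C ⊎ i ≡ index p₂∈C
  b-only i b[i] = Sum.map (λ Cᵢ≡p₁ → lookup-injective C! (trans Cᵢ≡p₁ (lookup-index p₁∈C)))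
                          (λ Cᵢ≡p₂ → lookup-injective C! (trans Cᵢ≡p₂ (lookup-index p₂∈C)))
                          (only (List.lookup C i) (∈-lookup i) Cᵢ∉B)
    where
    Cᵢ∉B : List.lookup C i ∉ select C b
    Cᵢ∉B Cᵢ∈B = case trans (sym (∈-select⇒lookup C! b i Cᵢ∈B)) b[i] of λ ()

pivotPair⁻ : {C : List (Point n)} {m : ℕ} → Unique C → (b : Vec Bool (length C)) → HasExtType C (select C b) 5 5 m →
             Σ[ P ∈ PivotPair C m ] (select C b ≡ PivotPair.basis P)
pivotPair⁻ {C = C} {m} C! b
  (p₁ , p₂ , p₁≢p₂ , p₁∈C , p₁∉B , p₂∈C , p₂∉B , only , T₁ , T₂ ,
   T₁⊆B , T₁-odd , ΣT₁ , T₂⊆B , T₂-odd , ΣT₂ , |T₁| , |T₂| , |T₁∩T₂|)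
  with ⊆-select C b T₁⊆B | ⊆-select C b T₂⊆B
... | t₁ , t₁⊑b , refl | t₂ , t₂⊑b , refl = P , cong (select C) b≡except
  where
  j₁ j₂ : Fin (length C)
  j₁ = index p₁∈C
  j₂ = index p₂∈C
  j₁≢j₂ : j₁ ≢ j₂
  j₁≢j₂ = index-≢ p₁∈C p₂∈C p₁≢p₂
  b≡except : b ≡ except j₁ j₂
  b≡except = ≡except-index C! b p₁∈C p₂∈C p₁≢p₂ p₁∉B p₂∉B only
  t⊑except : ∀ {t} → t ⊑ b → t ⊑ except j₁ j₂
  t⊑except = subst (_ ⊑_) b≡except
  r₁ r₂ : Vec Bool (length C)
  r₁ = t₁ [ j₁ ]≔ true
  r₂ = t₂ [ j₂ ]≔ true
  t₁[j₁] : lookup t₁ j₁ ≡ false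
  t₁[j₁] = lookup-⊑-false (t⊑except t₁⊑b) (lookup-except₁ j₁≢j₂)
  t₂[j₂] : lookup t₂ j₂ ≡ false
  t₂[j₂] = lookup-⊑-false (t⊑except t₂⊑b) (lookup-except₂ j₁≢j₂)
  r₁[j₂] : lookup r₁ j₂ ≡ false
  r₁[j₂] = trans (lookup∘update′ (j₁≢j₂ ∘ sym) t₁ true) (lookup-⊑-false (t⊑except t₁⊑b) (lookup-except₂ j₁≢j₂))
  r₂[j₁] : lookup r₂ j₁ ≡ false
  r₂[j₁] = trans (lookup∘update′ j₁≢j₂ t₂ true) (lookup-⊑-false (t⊑except t₂⊑b) (lookup-except₁ j₁≢j₂))
  completed₁ : Relation C r₁ × weight r₁ ≡ 6
  completed₁ = completed-relation C j₁ t₁[j₁] T₁-odd (trans ΣT₁ (lookup-index p₁∈C)) |T₁|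
  completed₂ : Relation C r₂ × weight r₂ ≡ 6
  completed₂ = completed-relation C j₂ t₂[j₂] T₂-odd (trans ΣT₂ (lookup-index p₂∈C)) |T₂|
  uncomplete : ∀ {t : Vec Bool (length C)} {j} → lookup t j ≡ false → t [ j ]≔ true [ j ]≔ false ≡ t
  uncomplete {t} {j} t[j] = trans ([]≔-idempotent t j) ([]≔-id t j t[j])
  meet : weight (r₁ ⊓ r₂) ≡ m
  meet = begin
    weight (r₁ ⊓ r₂)                                                 ≡⟨ cong weight (except-⊓ j₁≢j₂ r₂[j₁] r₁[j₂]) ⟨
    weight (except j₁ j₂ ⊓ ((r₁ [ j₁ ]≔ false) ⊓ (r₂ [ j₂ ]≔ false)))  ≡⟨ cong weight (cong₂ _⊓_ (sym b≡except) (cong₂ _⊓_ (uncomplete t₁[j₁]) (uncomplete t₂[j₂]))) ⟩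
    weight (b ⊓ (t₁ ⊓ t₂))                                           ≡⟨ ∣∩∣in-select C! b t₁ t₂ ⟨
    ∣ select C t₁ ∩ select C t₂ ∣in select C b                       ≡⟨ |T₁∩T₂| ⟩
    m                                                                ∎
    where open ≡-Reasoning
  P : PivotPair C m
  P = record
    { x₁ = j₁ ; x₂ = j₂ ; r₁ = r₁ ; r₂ = r₂
    ; relation₁ = proj₁ completed₁ ; relation₂ = proj₁ completed₂
    ; r₁[x₁] = lookup∘update j₁ t₁ true ; r₂[x₂] = lookup∘update j₂ t₂ true
    ; r₁[x₂] = r₁[j₂] ; r₂[x₁] = r₂[j₁]
    ; weight₁ = proj₂ completed₁ ; weight₂ = proj₂ completed₂ ; weight-meet = meet
    }

cap⇒basis : {C : List (Point n)} → Unique C → length C ≡ 10 → HasDim C 7 → IsCap C →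
            HasBasisOfExtType C 5 5 2 ⊎ HasBasisOfExtType C 5 5 3
cap⇒basis {C = C} C! |C|≡10 (A , _ , A-indep , A≈C , |A|≡8) cap =
  let w₁ , w₂ , nz₁ , nz₂ , w₁≢w₂                  = two-relations (≤-reflexive (sym |C|≡2+|A|)) C⊆ᵃA
      r₁ , r₂ , rel₁ , rel₂ , r₁≢r₂ , |r₁| , |r₂| = weight-6-pair C! cap |C|≡10 nz₁ nz₂ w₁≢w₂
      m , m∈ , P                                   = pivotPair⁺ C! cap |C|≡10 rel₁ rel₂ r₁≢r₂ |r₁| |r₂|
      basis : HasBasisOfExtType C 5 5 m
      basis = PivotPair.hasBasisOfExtType P C! (PivotPair.basis-AffIndep P A-indep A⊆ᵃC |C|≡2+|A|)
  in Sum.map (λ m≡2 → subst (HasBasisOfExtType C 5 5) m≡2 basis)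
             (λ m≡3 → subst (HasBasisOfExtType C 5 5) m≡3 basis) m∈
  where
  C⊆ᵃA : C ⊆ᵃ A
  C⊆ᵃA x = proj₂ (A≈C x)
  A⊆ᵃC : A ⊆ᵃ C
  A⊆ᵃC x = proj₁ (A≈C x)
  |C|≡2+|A| : length C ≡ 2 + length A
  |C|≡2+|A| = trans |C|≡10 (sym (cong (2 +_) |A|≡8))

basis⇒cap : {C : List (Point n)} {m : ℕ} → Unique C → m ≡ 2 ⊎ m ≡ 3 → HasBasisOfExtType C 5 5 m → IsCap C
basis⇒cap {C = C} C! m∈ (B , (B⊆C , B-indep , _) , ext) with ⊆⇒select C B⊆C
... | b , refl = let P , B≡basis = pivotPair⁻ C! b ext in PivotPair.isCap P m∈ (subst AffIndep B≡basis B-indep)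

theorem5p4 : (n : ℕ) (C : List (Point n)) → Unique C → length C ≡ 10 → HasDim C 7 →
    (IsCap C → HasBasisOfExtType C 5 5 2 ⊎ HasBasisOfExtType C 5 5 3) ×
    (HasBasisOfExtType C 5 5 2 ⊎ HasBasisOfExtType C 5 5 3 → IsCap C)
theorem5p4 n C C! |C|≡10 dim =
  cap⇒basis C! |C|≡10 dim , [ basis⇒cap C! (inj₁ refl) , basis⇒cap C! (inj₂ refl) ]′
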